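{- Let $c=(c_1,\ldots,c_r)$ be a profile of rank $r$ and level $\ell$, and for $n\ge0$ let $f_{n,c}(q)=\sum_\Lambda q^{|\Lambda|}$, summed over all cylindric partitions $\Lambda$ with profile $c$ and all parts at most $n$. Define $P_{n,c}(q)=(q^r;q^r)_n f_{n,c}(q)$. Then $P_{n,c}(q)$ is a polynomial with positive coefficients, and $P_{n,c}(1)=\binom{\ell+r-1}{r-1}^n$.
   Context: A profile is a composition $c=(c_1,\ldots,c_r)$ of nonnegative integers with $\ell=c_1+\cdots+c_r>0$; $r$ is the rank, $\ell$ the level. A cylindric partition with profile $c$ is a tuple $\Lambda=(\lambda^{(1)},\ldots,\lambda^{(r)})$ of integer partitions such that for all $j\ge1$: $\lambda^{(i)}_j\ge\lambda^{(i+1)}_{j+c_{i+1}}$ for $1\le i\le r-1$, and $\lambda^{(r)}_j\ge\lambda^{(1)}_{j+c_1}$ (missing parts taken as $0$). $|\Lambda|$ is the sum of all parts. $(a;q)_n=\prod_{j=1}^n(1-aq^{j-1})$. "Positive coefficients" means all nonzero coefficients are positive. -}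

module Defs where

open import Data.Nat using (ℕ; zero; suc; _+_; _*_; _∸_; _≤_; _<_; _≥_; _≤ᵇ_)
open import Data.Integer as ℤ using (ℤ; +_; _-_)
open import Data.Bool using (if_then_else_)
open import Data.List using (List; []; _∷_)
open import Data.Nat.ListAction using (sum)
open import Data.List.Relation.Unary.All using (All)
open import Data.List.Relation.Unary.Linked using (Linked)
open import Data.List.Relation.Unary.Unique.Propositional using (Unique)
open import Data.List.Membership.Propositional using (_∈_)
open import Data.Vec as Vec using (Vec)
import Data.Vec.Relation.Unary.All as VAll
open import Data.Product using (_×_)
open import Relation.Binary.PropositionalEquality using (_≡_)

-- 0-based lookup in a list with default 0 (missing parts are 0)
nth0 : List ℕ → ℕ → ℕ
nth0 []       _       = 0
nth0 (x ∷ _)  zero    = x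
nth0 (_ ∷ xs) (suc j) = nth0 xs j

part : List ℕ → ℕ → ℕ
part l j = nth0 l (j ∸ 1)

-- 1-based lookup of the i-th component of a tuple (default [] / 0 out of range)
compL : ∀ {r} → Vec (List ℕ) r → ℕ → List ℕ
compL Vec.[]       _             = []
compL (x Vec.∷ _)  (suc zero)    = x
compL (_ Vec.∷ xs) (suc (suc i)) = compL xs (suc i)
compL (_ Vec.∷ _)  zero          = []

compN : ∀ {r} → Vec ℕ r → ℕ → ℕ
compN Vec.[]       _             = 0
compN (x Vec.∷ _)  (suc zero)    = x
compN (_ Vec.∷ xs) (suc (suc i)) = compN xs (suc i)
compN (_ Vec.∷ _)  zero          = 0

IsPartition : List ℕ → Set
IsPartition l = All (λ x → 1 ≤ x) l × Linked _≥_ l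

level : ∀ {r} → Vec ℕ r → ℕ
level c = Vec.sum c

Tuple : ℕ → Set
Tuple r = Vec (List ℕ) r

IsCylindric : ∀ {r} → Vec ℕ r → Tuple r → Set
IsCylindric {r} c Λ =
  VAll.All IsPartition Λ ×
  (∀ i j → 1 ≤ i → i < r → 1 ≤ j →
     part (compL Λ (suc i)) (j + compN c (suc i)) ≤ part (compL Λ i) j) ×
  (∀ j → 1 ≤ j → part (compL Λ 1) (j + compN c 1) ≤ part (compL Λ r) j)

PartsAtMost : ∀ {r} → ℕ → Tuple r → Set
PartsAtMost n Λ = VAll.All (All (λ x → x ≤ n)) Λ

size : ∀ {r} → Tuple r → ℕ
size Vec.[]       = 0
size (l Vec.∷ Λ)  = sum l + size Λ

Enumerates : ∀ {r} → Vec ℕ r → ℕ → ℕ → List (Tuple r) → Set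
Enumerates c n m L =
  Unique L ×
  (∀ Λ → (Λ ∈ L → IsCylindric c Λ × PartsAtMost n Λ × size Λ ≡ m) ×
         (IsCylindric c Λ × PartsAtMost n Λ × size Λ ≡ m → Λ ∈ L))

-- power series as coefficient functions ℕ → ℤ
Series : Set
Series = ℕ → ℤ

-- (1 - q^k) · g
oneMinusTimes : ℕ → Series → Series
oneMinusTimes k g m = g m - (if k ≤ᵇ m then g (m ∸ k) else + 0)

-- (q^r; q^r)_j · g  =  ∏_{i=1}^{j} (1 - q^{r i}) · g
pochTimes : ℕ → ℕ → Series → Series
pochTimes r zero    g = g
pochTimes r (suc j) g = oneMinusTimes (r * suc j) (pochTimes r j g)

sumTo : ℕ → Series → ℤ
sumTo zero    g = g 0
sumTo (suc D) g = sumTo D g ℤ.+ g (suc D)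

module Submission where

-- Write T = n + 1 and let M_k be the number of parts equal to T in the k-th component of a cylindric
-- partition with profile c and parts at most T. Removing these runs leaves a cylindric partition with
-- parts at most n and profile c′_k = c_k + M_{k-1} - M_k (indices mod r), again of level ℓ. If every M_k
-- is positive, the partition is instead T prepended to each component of a partition counted by f_{T,c}.
-- Otherwise M has a zero entry; such M are determined by c′ (as partial sums of c - c′ shifted to have
-- minimum 0), and every profile c′ of level ℓ occurs. Hence
--   (1 - q^{rT}) f_{T,c} = Σ_{c′} q^{T·|M|} f_{n,c′},
-- a sum over binom(ℓ+r-1, r-1) profiles, so multiplying by (q^r;q^r)_n gives
--   P_{T,c} = Σ_{c′} q^{T·|M|} P_{n,c′}.
-- Induction on n from P_{0,c} = 1 yields positivity and P_{n,c}(1) = binom(ℓ+r-1, r-1)^n.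

module CylindricPartitions where

  open import Defs
  open import Data.Bool using (true; false; if_then_else_)
  open import Data.Empty using (⊥; ⊥-elim)
  open import Data.Integer as ℤ using (ℤ; +_; _-_; ∣_∣)
  import Data.Integer.Properties as ℤP
  open import Data.Integer.Tactic.RingSolver using (solve-∀)
  open import Data.List as List using (List; []; _∷_; length; map; filter; _++_; replicate)
  open import Data.List.Properties using (map-cong; ++-cancelˡ; length-map; length-++)
  import Data.List.Relation.Unary.Unique.Propositional.Properties as UniqueP
  open import Data.List.Membership.Propositional using (_∈_; _∉_)
  open import Data.List.Membership.Propositional.Properties
    using (∈-map⁺; ∈-map⁻; ∈-++⁺ˡ; ∈-++⁺ʳ; ∈-++⁻; ∈-filter⁺; ∈-filter⁻)
  open import Data.List.Membership.Propositional.Properties.WithK using (unique∧set⇒bag)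
  open import Data.List.Relation.Binary.BagAndSetEquality using (∼bag⇒↭; _∼[_]_; set)
  open import Data.List.Relation.Binary.Permutation.Propositional.Properties using (↭-length)
  open import Data.List.Relation.Unary.All as All using (All; []; _∷_)
  import Data.List.Relation.Unary.All.Properties as AllP
  open import Data.List.Relation.Unary.Linked as Linked using (Linked; []; [-]; _∷_)
  open import Data.List.Relation.Unary.Linked.Properties using (Linked⇒All)
  open import Data.List.Relation.Unary.Any using (here; there)
  open import Data.List.Relation.Unary.Unique.Propositional using (Unique; []; _∷_)
  open import Data.Nat as ℕ
    using (ℕ; zero; suc; _+_; _*_; _∸_; _^_; _≤_; _<_; _≥_; _≤ᵇ_; _≤?_; _<?_; _≟_; _⊔_; s≤s; z≤n)
  import Data.Nat.Properties as ℕP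
  open import Algebra.Properties.CommutativeSemigroup ℕP.+-commutativeSemigroup
    using (xy∙z≈y∙zx; x∙yz≈y∙xz) renaming (interchange to +-interchange)
  open import Algebra.Properties.CommutativeSemigroup ℤP.+-commutativeSemigroup
    using () renaming (interchange to ℤ+-interchange)
  open import Data.Nat.ListAction using (sum)
  open import Data.Nat.Combinatorics using (_C_; nCn≡1; nCk+nC[k+1]≡[n+1]C[k+1])
  open import Data.Vec as Vec using (Vec; []; _∷_)
  import Data.Vec.Properties as VecP
  import Data.Vec.Relation.Unary.All as VAll
  open VAll using ([]; _∷_)
  open import Data.Product using (Σ; _×_; _,_; proj₁; proj₂; map₁)
  open import Data.Sum using (inj₁; inj₂)
  open import Relation.Binary.Definitions using (DecidableEquality)
  open import Relation.Binary.PropositionalEquality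
  open import Function using (id; _∘_)
  open import Function.Bundles using (mk⇔)
  open import Relation.Nullary using (Dec; ¬_; yes; no; ¬?; contradiction)
  open import Relation.Nullary.Reflects using (ofʸ; ofⁿ)
  open import Relation.Unary using (Pred; Decidable)

  length-unique-∼set : ∀ {a} {A : Set a} {xs ys : List A} →
    Unique xs → Unique ys → xs ∼[ set ] ys → length xs ≡ length ys
  length-unique-∼set ux uy xs∼ys = ↭-length (∼bag⇒↭ (unique∧set⇒bag ux uy xs∼ys))

  map⁺-injectiveOn : ∀ {a b} {A : Set a} {B : Set b} (f : A → B) {xs : List A} → Unique xs →
    (∀ {x y} → x ∈ xs → y ∈ xs → f x ≡ f y → x ≡ y) → Unique (map f xs)
  map⁺-injectiveOn f {[]}     []         inj = []
  map⁺-injectiveOn f {x ∷ xs} (x∉xs ∷ u) inj =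
    AllP.map⁺ (All.tabulate λ y∈ fx≡fy → All.lookup x∉xs y∈ (inj (here refl) (there y∈) fx≡fy)) ∷
    map⁺-injectiveOn f u (λ p q → inj (there p) (there q))

  length-empty : ∀ {a} {A : Set a} (xs : List A) → (∀ {x} → x ∉ xs) → length xs ≡ 0
  length-empty []      _   = refl
  length-empty (x ∷ _) x∉ = ⊥-elim (x∉ (here refl))

  length-map-++-map : ∀ {a b c} {A : Set a} {B : Set b} {C : Set c} (f : A → C) (g : B → C) xs ys →
    length (map f xs ++ map g ys) ≡ length xs + length ys
  length-map-++-map f g xs ys =
    trans (length-++ (map f xs) {map g ys}) (cong₂ _+_ (length-map f xs) (length-map g ys))

  length-filter-∁ : ∀ {a p} {A : Set a} {P : Pred A p} (P? : Decidable P) (xs : List A) →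
    length xs ≡ length (filter P? xs) + length (filter (λ x → ¬? (P? x)) xs)
  length-filter-∁ P? [] = refl
  length-filter-∁ P? (x ∷ xs) with P? x
  ... | yes _ = cong suc (length-filter-∁ P? xs)
  ... | no _  = trans (cong suc (length-filter-∁ P? xs)) (sym (ℕP.+-suc _ _))

  sum-map-+ : ∀ {a} {A : Set a} (f g : A → ℕ) (xs : List A) →
    sum (map (λ x → f x + g x) xs) ≡ sum (map f xs) + sum (map g xs)
  sum-map-+ f g [] = refl
  sum-map-+ f g (x ∷ xs) = begin
    f x + g x + sum (map (λ x → f x + g x) xs)     ≡⟨ cong (λ s → f x + g x + s) (sum-map-+ f g xs) ⟩
    f x + g x + (sum (map f xs) + sum (map g xs))  ≡⟨ +-interchange (f x) (g x) (sum (map f xs)) (sum (map g xs)) ⟩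
    f x + sum (map f xs) + (g x + sum (map g xs))  ∎
    where open ≡-Reasoning

  sum-map-0 : ∀ {a} {A : Set a} (xs : List A) → sum (map (λ _ → 0) xs) ≡ 0
  sum-map-0 []       = refl
  sum-map-0 (_ ∷ xs) = sum-map-0 xs

  module Fibres {a k} {A : Set a} {K : Set k} (κ : A → K) (_≟_ : DecidableEquality K) where

    fibre : K → List A → List A
    fibre i = filter (λ x → κ x ≟ i)

    indicator : K → K → ℕ
    indicator j i with j ≟ i
    ... | yes _ = 1
    ... | no _  = 0

    length-fibre-∷ : ∀ i x X → length (fibre i (x ∷ X)) ≡ indicator (κ x) i + length (fibre i X)
    length-fibre-∷ i x X with κ x ≟ i
    ... | yes _ = refl
    ... | no _  = refl

    sum-indicator-∉ : ∀ j (I : List K) → j ∉ I → sum (map (indicator j) I) ≡ 0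
    sum-indicator-∉ j []      _   = refl
    sum-indicator-∉ j (i ∷ I) j∉ with j ≟ i
    ... | yes j≡i = ⊥-elim (j∉ (here j≡i))
    ... | no _    = sum-indicator-∉ j I (λ j∈ → j∉ (there j∈))

    sum-indicator-∈ : ∀ j (I : List K) → Unique I → j ∈ I → sum (map (indicator j) I) ≡ 1
    sum-indicator-∈ j (i ∷ I) (i∉I ∷ _) j∈ with j ≟ i
    ... | yes refl = cong suc (sum-indicator-∉ j I (λ j∈I → All.lookup i∉I j∈I refl))
    sum-indicator-∈ j (i ∷ I) (_ ∷ u) (here j≡i)  | no j≢i = ⊥-elim (j≢i j≡i)
    sum-indicator-∈ j (i ∷ I) (_ ∷ u) (there j∈I) | no _   = sum-indicator-∈ j I u j∈I

    length-≡-sum-fibres : (I : List K) → Unique I → (X : List A) → (∀ {x} → x ∈ X → κ x ∈ I) →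
      length X ≡ sum (map (λ i → length (fibre i X)) I)
    length-≡-sum-fibres I u [] _ = sym (sum-map-0 I)
    length-≡-sum-fibres I u (x ∷ X) keys = sym (begin
      sum (map (λ i → length (fibre i (x ∷ X))) I)
        ≡⟨ cong sum (map-cong (λ i → length-fibre-∷ i x X) I) ⟩
      sum (map (λ i → indicator (κ x) i + length (fibre i X)) I)
        ≡⟨ sum-map-+ (indicator (κ x)) (λ i → length (fibre i X)) I ⟩
      sum (map (indicator (κ x)) I) + sum (map (λ i → length (fibre i X)) I)
        ≡⟨ cong₂ _+_ (sum-indicator-∈ (κ x) I u (keys (here refl)))
                     (sym (length-≡-sum-fibres I u X (λ x∈ → keys (there x∈)))) ⟩
      suc (length X) ∎)
      where open ≡-Reasoning

  -- Power series

  -- q^k · g, chosen so that oneMinusTimes k g m is g m - shift k g m by definition.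
  shift : ℕ → Series → Series
  shift k g m = if k ≤ᵇ m then g (m ∸ k) else + 0

  shift-≤ : ∀ {k m} (g : Series) → k ≤ m → shift k g m ≡ g (m ∸ k)
  shift-≤ {k} {m} g k≤m with k ≤ᵇ m | ℕP.≤ᵇ-reflects-≤ k m
  ... | true  | _        = refl
  ... | false | ofⁿ k≰m = contradiction k≤m k≰m

  shift-< : ∀ {k m} (g : Series) → m < k → shift k g m ≡ + 0
  shift-< {k} {m} g m<k with k ≤ᵇ m | ℕP.≤ᵇ-reflects-≤ k m
  ... | true  | ofʸ k≤m = contradiction k≤m (ℕP.<⇒≱ m<k)
  ... | false | _        = refl

  shift-cong : ∀ k {f g : Series} → (∀ m → f m ≡ g m) → ∀ m → shift k f m ≡ shift k g m
  shift-cong k f≗g m with k ≤ᵇ m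
  ... | true  = f≗g (m ∸ k)
  ... | false = refl

  shift-zipWith : (_∙_ : ℤ → ℤ → ℤ) → (+ 0) ∙ (+ 0) ≡ + 0 → ∀ k (f g : Series) m →
    shift k (λ x → f x ∙ g x) m ≡ shift k f m ∙ shift k g m
  shift-zipWith _∙_ 0∙0 k f g m with k ≤ᵇ m
  ... | true  = refl
  ... | false = sym 0∙0

  shift-translate : ∀ k k′ (g : Series) j → shift (k + k′) g (k + j) ≡ shift k′ g j
  shift-translate k k′ g j with k′ ≤? j
  ... | yes k′≤j = trans (shift-≤ g (ℕP.+-monoʳ-≤ k k′≤j))
                         (trans (cong g (ℕP.[m+n]∸[m+o]≡n∸o k j k′)) (sym (shift-≤ g k′≤j)))
  ... | no k′≰j  = trans (shift-< g (ℕP.+-monoʳ-< k (ℕP.≰⇒> k′≰j)))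
                         (sym (shift-< g (ℕP.≰⇒> k′≰j)))

  shift-shift : ∀ k k′ (g : Series) m → shift k (shift k′ g) m ≡ shift (k + k′) g m
  shift-shift k k′ g m with k ≤? m
  ... | no k≰m  = trans (shift-< (shift k′ g) (ℕP.≰⇒> k≰m))
                        (sym (shift-< g (ℕP.<-≤-trans (ℕP.≰⇒> k≰m) (ℕP.m≤m+n k k′))))
  ... | yes k≤m = begin
    shift k (shift k′ g) m          ≡⟨ shift-≤ (shift k′ g) k≤m ⟩
    shift k′ g (m ∸ k)              ≡⟨ sym (shift-translate k k′ g (m ∸ k)) ⟩
    shift (k + k′) g (k + (m ∸ k))  ≡⟨ cong (shift (k + k′) g) (ℕP.m+[n∸m]≡n k≤m) ⟩
    shift (k + k′) g m              ∎
    where open ≡-Reasoning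

  shift-comm : ∀ k k′ (g : Series) m → shift k (shift k′ g) m ≡ shift k′ (shift k g) m
  shift-comm k k′ g m = begin
    shift k (shift k′ g) m  ≡⟨ shift-shift k k′ g m ⟩
    shift (k + k′) g m      ≡⟨ cong (λ i → shift i g m) (ℕP.+-comm k k′) ⟩
    shift (k′ + k) g m      ≡⟨ sym (shift-shift k′ k g m) ⟩
    shift k′ (shift k g) m  ∎
    where open ≡-Reasoning

  pochTimes-cong : ∀ r j {f g : Series} → (∀ m → f m ≡ g m) → ∀ m → pochTimes r j f m ≡ pochTimes r j g m
  pochTimes-cong r zero    f≗g m = f≗g m
  pochTimes-cong r (suc j) f≗g m =
    cong₂ _-_ (pochTimes-cong r j f≗g m) (shift-cong (r * suc j) (pochTimes-cong r j f≗g) m)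

  pochTimes-zipWith : (_∙_ : ℤ → ℤ → ℤ) → (∀ a b c d → (a - c) ∙ (b - d) ≡ (a ∙ b) - (c ∙ d)) →
    ∀ r j (f g : Series) m → pochTimes r j (λ x → f x ∙ g x) m ≡ pochTimes r j f m ∙ pochTimes r j g m
  pochTimes-zipWith _∙_ ∙-sub r zero    f g m = refl
  pochTimes-zipWith _∙_ ∙-sub r (suc j) f g m = begin
    P (λ x → f x ∙ g x) m - shift k (P (λ x → f x ∙ g x)) m
      ≡⟨ cong₂ _-_ (pochTimes-zipWith _∙_ ∙-sub r j f g m)
                   (shift-cong k (pochTimes-zipWith _∙_ ∙-sub r j f g) m) ⟩
    (P f m ∙ P g m) - shift k (λ x → P f x ∙ P g x) m
      ≡⟨ cong ((P f m ∙ P g m) -_) (shift-zipWith _∙_ 0∙0 k (P f) (P g) m) ⟩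
    (P f m ∙ P g m) - (shift k (P f) m ∙ shift k (P g) m)
      ≡⟨ sym (∙-sub (P f m) (P g m) (shift k (P f) m) (shift k (P g) m)) ⟩
    (P f m - shift k (P f) m) ∙ (P g m - shift k (P g) m) ∎
    where
    open ≡-Reasoning
    P : Series → Series
    P = pochTimes r j
    k : ℕ
    k = r * suc j
    0∙0 : (+ 0) ∙ (+ 0) ≡ + 0
    0∙0 = trans (∙-sub (+ 0) (+ 0) (+ 0) (+ 0)) (ℤP.+-inverseʳ ((+ 0) ∙ (+ 0)))

  pochTimes-+ : ∀ r j (f g : Series) m →
    pochTimes r j (λ x → f x ℤ.+ g x) m ≡ pochTimes r j f m ℤ.+ pochTimes r j g m
  pochTimes-+ = pochTimes-zipWith ℤ._+_ solve-∀

  pochTimes-− : ∀ r j (f g : Series) m →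
    pochTimes r j (λ x → f x - g x) m ≡ pochTimes r j f m - pochTimes r j g m
  pochTimes-− = pochTimes-zipWith _-_ solve-∀

  pochTimes-0 : ∀ r j m → pochTimes r j (λ _ → + 0) m ≡ + 0
  pochTimes-0 r j m =
    trans (pochTimes-− r j (λ _ → + 0) (λ _ → + 0) m) (ℤP.+-inverseʳ (pochTimes r j (λ _ → + 0) m))

  pochTimes-shift : ∀ r j w (g : Series) m → pochTimes r j (shift w g) m ≡ shift w (pochTimes r j g) m
  pochTimes-shift r zero    w g m = refl
  pochTimes-shift r (suc j) w g m = begin
    P (shift w g) m - shift k (P (shift w g)) m
      ≡⟨ cong₂ _-_ (pochTimes-shift r j w g m) (shift-cong k (pochTimes-shift r j w g) m) ⟩
    shift w (P g) m - shift k (shift w (P g)) m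
      ≡⟨ cong (shift w (P g) m -_) (shift-comm k w (P g) m) ⟩
    shift w (P g) m - shift w (shift k (P g)) m
      ≡⟨ sym (shift-zipWith _-_ refl w (P g) (shift k (P g)) m) ⟩
    shift w (λ x → P g x - shift k (P g) x) m ∎
    where
    open ≡-Reasoning
    P : Series → Series
    P = pochTimes r j
    k : ℕ
    k = r * suc j

  pochTimes-oneMinusTimes : ∀ r j k (g : Series) m →
    pochTimes r j (oneMinusTimes k g) m ≡ oneMinusTimes k (pochTimes r j g) m
  pochTimes-oneMinusTimes r j k g m =
    trans (pochTimes-− r j g (shift k g) m) (cong (pochTimes r j g m -_) (pochTimes-shift r j k g m))

  sumSeries : ∀ {a} {X : Set a} → List X → (X → Series) → Series
  sumSeries []      F m = + 0
  sumSeries (x ∷ I) F m = F x m ℤ.+ sumSeries I F m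

  sumSeries-cong : ∀ {a} {X : Set a} (I : List X) {F G : X → Series} →
    (∀ {x} → x ∈ I → ∀ m → F x m ≡ G x m) → ∀ m → sumSeries I F m ≡ sumSeries I G m
  sumSeries-cong []      F≗G m = refl
  sumSeries-cong (x ∷ I) F≗G m =
    cong₂ ℤ._+_ (F≗G (here refl) m) (sumSeries-cong I (λ x∈ → F≗G (there x∈)) m)

  pochTimes-sumSeries : ∀ {a} {X : Set a} r j (I : List X) (F : X → Series) m →
    pochTimes r j (sumSeries I F) m ≡ sumSeries I (λ x → pochTimes r j (F x)) m
  pochTimes-sumSeries r j []      F m = pochTimes-0 r j m
  pochTimes-sumSeries r j (x ∷ I) F m =
    trans (pochTimes-+ r j (F x) (sumSeries I F) m)
          (cong (λ z → pochTimes r j (F x) m ℤ.+ z) (pochTimes-sumSeries r j I F m))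

  +-sum≡sumSeries : ∀ {a} {X : Set a} (I : List X) (f : X → ℕ) (F : X → Series) m →
    (∀ {x} → x ∈ I → + f x ≡ F x m) → + sum (map f I) ≡ sumSeries I F m
  +-sum≡sumSeries []      f F m _   = refl
  +-sum≡sumSeries (x ∷ I) f F m f≡F =
    cong₂ ℤ._+_ (f≡F (here refl)) (+-sum≡sumSeries I f F m (λ x∈ → f≡F (there x∈)))

  NonNegPoly : Series → ℕ → ℤ → Set
  NonNegPoly g D v = (∀ m → D < m → g m ≡ + 0) × (∀ m → + 0 ℤ.≤ g m) × (sumTo D g ≡ v)

  sumTo-cong : ∀ D {f g : Series} → (∀ m → f m ≡ g m) → sumTo D f ≡ sumTo D g
  sumTo-cong zero    f≗g = f≗g 0
  sumTo-cong (suc D) f≗g = cong₂ ℤ._+_ (sumTo-cong D f≗g) (f≗g (suc D))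

  sumTo-+ : ∀ D (f g : Series) → sumTo D (λ m → f m ℤ.+ g m) ≡ sumTo D f ℤ.+ sumTo D g
  sumTo-+ zero    f g = refl
  sumTo-+ (suc D) f g = trans (cong (λ z → z ℤ.+ (f (suc D) ℤ.+ g (suc D))) (sumTo-+ D f g))
                              (ℤ+-interchange (sumTo D f) (sumTo D g) (f (suc D)) (g (suc D)))

  sumTo-beyond : ∀ {D} D′ (g : Series) → (∀ m → D < m → g m ≡ + 0) → D ≤ D′ →
    sumTo D′ g ≡ sumTo D g
  sumTo-beyond zero     g van z≤n = refl
  sumTo-beyond {D} (suc D′) g van D≤1+D′ with D ≤? D′
  ... | yes D≤D′ = trans (cong₂ ℤ._+_ (sumTo-beyond D′ g van D≤D′) (van (suc D′) (s≤s D≤D′)))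
                         (ℤP.+-identityʳ (sumTo D g))
  ... | no D≰D′  = cong (λ i → sumTo i g) (ℕP.≤-antisym (ℕP.≰⇒> D≰D′) D≤1+D′)

  sumTo-shift-< : ∀ {w} D (g : Series) → D < w → sumTo D (shift w g) ≡ + 0
  sumTo-shift-< zero    g 0<w   = shift-< g 0<w
  sumTo-shift-< (suc D) g 1+D<w =
    cong₂ ℤ._+_ (sumTo-shift-< D g (ℕP.<-trans (ℕP.n<1+n D) 1+D<w)) (shift-< g 1+D<w)

  sumTo-shift-self : ∀ w (g : Series) → sumTo w (shift w g) ≡ g 0
  sumTo-shift-self zero    g = refl
  sumTo-shift-self (suc w) g = begin
    sumTo w (shift (suc w) g) ℤ.+ shift (suc w) g (suc w)
      ≡⟨ cong₂ ℤ._+_ (sumTo-shift-< w g ℕP.≤-refl) (shift-≤ g (ℕP.≤-refl {suc w})) ⟩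
    + 0 ℤ.+ g (w ∸ w)  ≡⟨ ℤP.+-identityˡ (g (w ∸ w)) ⟩
    g (w ∸ w)          ≡⟨ cong g (ℕP.n∸n≡0 w) ⟩
    g 0                ∎
    where open ≡-Reasoning

  sumTo-shift : ∀ w D (g : Series) → sumTo (w + D) (shift w g) ≡ sumTo D g
  sumTo-shift w zero    g = trans (cong (λ i → sumTo i (shift w g)) (ℕP.+-identityʳ w)) (sumTo-shift-self w g)
  sumTo-shift w (suc D) g = begin
    sumTo (w + suc D) (shift w g)
      ≡⟨ cong (λ i → sumTo i (shift w g)) (ℕP.+-suc w D) ⟩
    sumTo (w + D) (shift w g) ℤ.+ shift w g (suc (w + D))
      ≡⟨ cong₂ ℤ._+_ (sumTo-shift w D g) (shift-≤ g (ℕP.m≤n⇒m≤1+n (ℕP.m≤m+n w D))) ⟩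
    sumTo D g ℤ.+ g (suc (w + D) ∸ w)
      ≡⟨ cong (λ i → sumTo D g ℤ.+ g i)
              (trans (cong (_∸ w) (sym (ℕP.+-suc w D))) (ℕP.m+n∸m≡n w (suc D))) ⟩
    sumTo D g ℤ.+ g (suc D) ∎
    where open ≡-Reasoning

  NonNegPoly-cong : ∀ {f g : Series} {D v} → (∀ m → f m ≡ g m) → NonNegPoly f D v → NonNegPoly g D v
  NonNegPoly-cong {D = D} f≗g (van , nonneg , total) =
    (λ m D<m → trans (sym (f≗g m)) (van m D<m)) ,
    (λ m → subst (+ 0 ℤ.≤_) (f≗g m) (nonneg m)) ,
    trans (sym (sumTo-cong D f≗g)) total

  NonNegPoly-shift : ∀ w {g : Series} {D v} → NonNegPoly g D v → NonNegPoly (shift w g) (w + D) v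
  NonNegPoly-shift w {g} {D} (van , nonneg , total) = van′ , nonneg′ , trans (sumTo-shift w D g) total
    where
    van′ : ∀ m → w + D < m → shift w g m ≡ + 0
    van′ m w+D<m = trans (shift-≤ g (ℕP.≤-trans (ℕP.m≤m+n w D) (ℕP.<⇒≤ w+D<m)))
                         (van (m ∸ w) (subst (_< m ∸ w) (ℕP.m+n∸m≡n w D)
                                             (ℕP.∸-monoˡ-< w+D<m (ℕP.m≤m+n w D))))
    nonneg′ : ∀ m → + 0 ℤ.≤ shift w g m
    nonneg′ m with w ≤? m
    ... | yes w≤m = subst (+ 0 ℤ.≤_) (sym (shift-≤ g w≤m)) (nonneg (m ∸ w))
    ... | no w≰m  = subst (+ 0 ℤ.≤_) (sym (shift-< g (ℕP.≰⇒> w≰m))) ℤP.≤-refl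

  NonNegPoly-+ : ∀ {f g : Series} {D₁ D₂ u v} → NonNegPoly f D₁ u → NonNegPoly g D₂ v →
    NonNegPoly (λ m → f m ℤ.+ g m) (D₁ ⊔ D₂) (u ℤ.+ v)
  NonNegPoly-+ {f} {g} {D₁} {D₂} (van₁ , nonneg₁ , total₁) (van₂ , nonneg₂ , total₂) =
    (λ m D<m → cong₂ ℤ._+_ (van₁ m (ℕP.≤-<-trans (ℕP.m≤m⊔n D₁ D₂) D<m))
                           (van₂ m (ℕP.≤-<-trans (ℕP.m≤n⊔m D₁ D₂) D<m))) ,
    (λ m → ℤP.+-mono-≤ (nonneg₁ m) (nonneg₂ m)) ,
    trans (sumTo-+ (D₁ ⊔ D₂) f g)
          (cong₂ ℤ._+_ (trans (sumTo-beyond (D₁ ⊔ D₂) f van₁ (ℕP.m≤m⊔n D₁ D₂)) total₁)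
                       (trans (sumTo-beyond (D₁ ⊔ D₂) g van₂ (ℕP.m≤n⊔m D₁ D₂)) total₂))

  NonNegPoly-sumSeries : ∀ {a} {X : Set a} (I : List X) (F : X → Series) (v : ℕ) →
    (∀ {x} → x ∈ I → Σ ℕ λ D → NonNegPoly (F x) D (+ v)) →
    Σ ℕ λ D → NonNegPoly (sumSeries I F) D (+ (length I * v))
  NonNegPoly-sumSeries []      F v _     = 0 , (λ _ _ → refl) , (λ _ → ℤP.≤-refl) , refl
  NonNegPoly-sumSeries (x ∷ I) F v polys
    with polys (here refl) | NonNegPoly-sumSeries I F v (λ x∈ → polys (there x∈))
  ... | D₁ , poly₁ | D₂ , poly₂ = D₁ ⊔ D₂ , NonNegPoly-+ poly₁ poly₂

  -- Partitions and their run of largest parts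

  leadingRun : ℕ → List ℕ → ℕ × List ℕ
  leadingRun T []       = 0 , []
  leadingRun T (x ∷ xs) with x ≟ T
  ... | yes _ = map₁ suc (leadingRun T xs)
  ... | no _  = 0 , x ∷ xs

  leadingCount : ℕ → List ℕ → ℕ
  leadingCount T l = proj₁ (leadingRun T l)

  dropLeading : ℕ → List ℕ → List ℕ
  dropLeading T l = proj₂ (leadingRun T l)

  replicate-leadingCount-++-dropLeading : ∀ T l → replicate (leadingCount T l) T ++ dropLeading T l ≡ l
  replicate-leadingCount-++-dropLeading T [] = refl
  replicate-leadingCount-++-dropLeading T (x ∷ xs) with x ≟ T
  ... | yes refl = cong (x ∷_) (replicate-leadingCount-++-dropLeading T xs)
  ... | no _     = refl

  leadingRun-replicate-++ : ∀ n a {l} → All (_≤ n) l → leadingRun (suc n) (replicate a (suc n) ++ l) ≡ (a , l)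
  leadingRun-replicate-++ n (suc a) l≤n with suc n ≟ suc n
  ... | yes _   = cong (map₁ suc) (leadingRun-replicate-++ n a l≤n)
  ... | no 1+n≢1+n = contradiction refl 1+n≢1+n
  leadingRun-replicate-++ n zero {[]}    _ = refl
  leadingRun-replicate-++ n zero {x ∷ l} (x≤n ∷ _) with x ≟ suc n
  ... | yes refl = contradiction x≤n (ℕP.n≮n n)
  ... | no _     = refl

  nth0-replicate-++-< : ∀ a T A {i} → i < a → nth0 (replicate a T ++ A) i ≡ T
  nth0-replicate-++-< (suc a) T A {zero}  _         = refl
  nth0-replicate-++-< (suc a) T A {suc i} (s≤s i<a) = nth0-replicate-++-< a T A i<a

  nth0-replicate-++-+ : ∀ a T A i → nth0 (replicate a T ++ A) (a + i) ≡ nth0 A i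
  nth0-replicate-++-+ zero    T A i = refl
  nth0-replicate-++-+ (suc a) T A i = nth0-replicate-++-+ a T A i

  nth0-≤ : ∀ {T} l i → All (_≤ T) l → nth0 l i ≤ T
  nth0-≤ []      i       _         = z≤n
  nth0-≤ (x ∷ l) zero    (x≤T ∷ _) = x≤T
  nth0-≤ (x ∷ l) (suc i) (_ ∷ l≤T) = nth0-≤ l i l≤T

  IsPartition-++⁻ʳ : ∀ xs {l} → IsPartition (xs ++ l) → IsPartition l
  IsPartition-++⁻ʳ []       p              = p
  IsPartition-++⁻ʳ (x ∷ xs) (_ ∷ pos , dec) = IsPartition-++⁻ʳ xs (pos , Linked.tail dec)

  Linked-≥-replicate-++ : ∀ a {T l} → All (_≤ T) l → Linked _≥_ l → Linked _≥_ (replicate a T ++ l)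
  Linked-≥-replicate-++ zero                _           dec = dec
  Linked-≥-replicate-++ (suc zero)    {l = []}    _           _   = [-]
  Linked-≥-replicate-++ (suc zero)    {l = _ ∷ _} (y≤T ∷ _) dec = y≤T ∷ dec
  Linked-≥-replicate-++ (suc (suc a))             l≤T         dec =
    ℕP.≤-refl ∷ Linked-≥-replicate-++ (suc a) l≤T dec

  IsPartition-replicate-++ : ∀ a n {l} → All (_≤ suc n) l → IsPartition l →
    IsPartition (replicate a (suc n) ++ l)
  IsPartition-replicate-++ a n l≤T (pos , dec) =
    AllP.++⁺ (AllP.replicate⁺ a (s≤s z≤n)) pos , Linked-≥-replicate-++ a l≤T dec

  dropLeading-≤ : ∀ n l → All (_≤ suc n) l → Linked _≥_ l → All (_≤ n) (dropLeading (suc n) l)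
  dropLeading-≤ n []       _           _   = []
  dropLeading-≤ n (x ∷ xs) (x≤T ∷ xs≤T) dec with x ≟ suc n
  ... | yes _   = dropLeading-≤ n xs xs≤T (Linked.tail dec)
  ... | no x≢T = x≤n ∷ All.map (λ y≤x → ℕP.≤-trans y≤x x≤n) (below dec)
    where
    x≤n : x ≤ n
    x≤n = ℕP.≤-pred (ℕP.≤∧≢⇒< x≤T x≢T)
    below : Linked _≥_ (x ∷ xs) → All (_≤ x) xs
    below [-]          = []
    below (x≥y ∷ dec′) = Linked⇒All (λ y≤z z≤w → ℕP.≤-trans z≤w y≤z) x≥y dec′

  sum-replicate-++ : ∀ a T l → sum (replicate a T ++ l) ≡ a * T + sum l
  sum-replicate-++ zero    T l = refl
  sum-replicate-++ (suc a) T l =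
    trans (cong (λ s → T + s) (sum-replicate-++ a T l)) (sym (ℕP.+-assoc T (a * T) (sum l)))

  Dominates : ℕ → List ℕ → List ℕ → Set
  Dominates k A B = ∀ i → nth0 B (i + k) ≤ nth0 A i

  block-index : ∀ a b k i → b ≤ k + a → a + i + k ≡ b + (i + (k + a ∸ b))
  block-index a b k i b≤k+a = begin
    a + i + k                  ≡⟨ xy∙z≈y∙zx a i k ⟩
    i + (k + a)                ≡⟨ cong (λ j → i + j) (sym (ℕP.m+[n∸m]≡n b≤k+a)) ⟩
    i + (b + (k + a ∸ b))      ≡⟨ x∙yz≈y∙xz i b (k + a ∸ b) ⟩
    b + (i + (k + a ∸ b))      ∎
    where open ≡-Reasoning

  Dominates-blocks⁻ : ∀ T a b k A B → b ≤ k + a →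
    Dominates k (replicate a T ++ A) (replicate b T ++ B) → Dominates (k + a ∸ b) A B
  Dominates-blocks⁻ T a b k A B b≤k+a dom i = begin
    nth0 B (i + (k + a ∸ b))                           ≡⟨ sym (nth0-replicate-++-+ b T B _) ⟩
    nth0 (replicate b T ++ B) (b + (i + (k + a ∸ b)))  ≡⟨ cong (nth0 (replicate b T ++ B)) (sym index≡) ⟩
    nth0 (replicate b T ++ B) (a + i + k)              ≤⟨ dom (a + i) ⟩
    nth0 (replicate a T ++ A) (a + i)                  ≡⟨ nth0-replicate-++-+ a T A i ⟩
    nth0 A i                                           ∎
    where
    open ℕP.≤-Reasoning
    index≡ : a + i + k ≡ b + (i + (k + a ∸ b))
    index≡ = block-index a b k i b≤k+a

  Dominates-blocks⁺ : ∀ T a b k A B → b ≤ k + a → All (_≤ T) B →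
    Dominates (k + a ∸ b) A B → Dominates k (replicate a T ++ A) (replicate b T ++ B)
  Dominates-blocks⁺ T a b k A B b≤k+a B≤T dom i with i <? a
  ... | yes i<a = subst (nth0 (replicate b T ++ B) (i + k) ≤_) (sym (nth0-replicate-++-< a T A i<a))
                        (nth0-≤ (replicate b T ++ B) (i + k) (AllP.++⁺ (AllP.replicate⁺ b ℕP.≤-refl) B≤T))
  ... | no i≮a  = subst (λ j → nth0 (replicate b T ++ B) (j + k) ≤ nth0 (replicate a T ++ A) j)
                        (ℕP.m+[n∸m]≡n (ℕP.≮⇒≥ i≮a)) (past-run (i ∸ a))
    where
    open ℕP.≤-Reasoning
    past-run : ∀ i → nth0 (replicate b T ++ B) (a + i + k) ≤ nth0 (replicate a T ++ A) (a + i)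
    past-run i = begin
      nth0 (replicate b T ++ B) (a + i + k)              ≡⟨ cong (nth0 (replicate b T ++ B)) index≡ ⟩
      nth0 (replicate b T ++ B) (b + (i + (k + a ∸ b)))  ≡⟨ nth0-replicate-++-+ b T B _ ⟩
      nth0 B (i + (k + a ∸ b))                           ≤⟨ dom i ⟩
      nth0 A i                                           ≡⟨ sym (nth0-replicate-++-+ a T A i) ⟩
      nth0 (replicate a T ++ A) (a + i)                  ∎
      where
      index≡ : a + i + k ≡ b + (i + (k + a ∸ b))
      index≡ = block-index a b k i b≤k+a

  -- nth0 A 0 ≤ n bounds entry a + k of the lower list, so its run of suc n's ends before that index.
  Dominates-blocks-≤ : ∀ n a b k A B → All (_≤ n) A →
    Dominates k (replicate a (suc n) ++ A) (replicate b (suc n) ++ B) → b ≤ k + a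
  Dominates-blocks-≤ n a b k A B A≤n dom with b ≤? k + a
  ... | yes b≤k+a = b≤k+a
  ... | no b≰k+a  = contradiction 1+n≤n (ℕP.n≮n n)
    where
    open ℕP.≤-Reasoning
    a+k<b : a + k < b
    a+k<b = subst (_< b) (ℕP.+-comm k a) (ℕP.≰⇒> b≰k+a)
    1+n≤n : suc n ≤ n
    1+n≤n = begin
      suc n                                    ≡⟨ sym (nth0-replicate-++-< b (suc n) B a+k<b) ⟩
      nth0 (replicate b (suc n) ++ B) (a + k)  ≤⟨ dom a ⟩
      nth0 (replicate a (suc n) ++ A) a        ≡⟨ cong (nth0 (replicate a (suc n) ++ A)) (sym (ℕP.+-identityʳ a)) ⟩
      nth0 (replicate a (suc n) ++ A) (a + 0)  ≡⟨ nth0-replicate-++-+ a (suc n) A 0 ⟩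
      nth0 A 0                                 ≤⟨ nth0-≤ A 0 A≤n ⟩
      n                                        ∎

  -- Tuples of partitions

  cyclicPred : ℕ → ℕ → ℕ
  cyclicPred r zero          = zero
  cyclicPred r (suc zero)    = r
  cyclicPred r (suc (suc k)) = suc k

  cyclicPred-range : ∀ r k → 1 ≤ k → k ≤ r → 1 ≤ cyclicPred r k × cyclicPred r k ≤ r
  cyclicPred-range r (suc zero)    _ k≤r = k≤r , ℕP.≤-refl
  cyclicPred-range r (suc (suc k)) _ k≤r = s≤s z≤n , ℕP.≤-trans (ℕP.n≤1+n _) k≤r

  compL-zipWith : ∀ {r} (f : ℕ → List ℕ → List ℕ) (M : Vec ℕ r) (Λ : Tuple r) k → 1 ≤ k → k ≤ r →
    compL (Vec.zipWith f M Λ) k ≡ f (compN M k) (compL Λ k)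
  compL-zipWith f (m ∷ M) (l ∷ Λ) (suc zero)    _ _         = refl
  compL-zipWith f (m ∷ M) (l ∷ Λ) (suc (suc k)) _ (s≤s k≤r) = compL-zipWith f M Λ (suc k) (s≤s z≤n) k≤r

  compL-All : ∀ {r} {P : List ℕ → Set} {Λ : Tuple r} → VAll.All P Λ →
    ∀ k → 1 ≤ k → k ≤ r → P (compL Λ k)
  compL-All (p ∷ _)  (suc zero)    _ _         = p
  compL-All (_ ∷ ps) (suc (suc k)) _ (s≤s k≤r) = compL-All ps (suc k) (s≤s z≤n) k≤r

  compN-All : ∀ {r} {P : ℕ → Set} {v : Vec ℕ r} → VAll.All P v →
    ∀ k → 1 ≤ k → k ≤ r → P (compN v k)
  compN-All (p ∷ _)  (suc zero)    _ _         = p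
  compN-All (_ ∷ ps) (suc (suc k)) _ (s≤s k≤r) = compN-All ps (suc k) (s≤s z≤n) k≤r

  compN-ext : ∀ {r} (u v : Vec ℕ r) → (∀ k → 1 ≤ k → k ≤ r → compN u k ≡ compN v k) → u ≡ v
  compN-ext []      []      _   = refl
  compN-ext (x ∷ u) (y ∷ v) u≗v =
    cong₂ _∷_ (u≗v 1 (s≤s z≤n) (s≤s z≤n))
              (compN-ext u v (λ { (suc k) _ k≤r → u≗v (suc (suc k)) (s≤s z≤n) (s≤s k≤r) }))

  tabulateFrom : ∀ len → ℕ → (ℕ → ℕ) → Vec ℕ len
  tabulateFrom zero      s f = []
  tabulateFrom (suc len) s f = f s ∷ tabulateFrom len (suc s) f

  compN-tabulateFrom : ∀ len s f i → i < len → compN (tabulateFrom len s f) (suc i) ≡ f (s + i)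
  compN-tabulateFrom (suc len) s f zero    _         = cong f (sym (ℕP.+-identityʳ s))
  compN-tabulateFrom (suc len) s f (suc i) (s≤s i<l) =
    trans (compN-tabulateFrom len (suc s) f i i<l) (cong f (sym (ℕP.+-suc s i)))

  compN-tabulate : ∀ r f k → 1 ≤ k → k ≤ r → compN (tabulateFrom r 1 f) k ≡ f k
  compN-tabulate r f (suc i) _ i<r = compN-tabulateFrom r 1 f i i<r

  addBlocks : ∀ {r} → ℕ → Vec ℕ r → Tuple r → Tuple r
  addBlocks T = Vec.zipWith (λ m l → replicate m T ++ l)

  leadingCounts : ∀ {r} → ℕ → Tuple r → Vec ℕ r
  leadingCounts T = Vec.map (leadingCount T)

  dropLeadings : ∀ {r} → ℕ → Tuple r → Tuple r
  dropLeadings T = Vec.map (dropLeading T)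

  compL-addBlocks : ∀ {r} T (M : Vec ℕ r) Λ k → 1 ≤ k → k ≤ r →
    compL (addBlocks T M Λ) k ≡ replicate (compN M k) T ++ compL Λ k
  compL-addBlocks T = compL-zipWith (λ m l → replicate m T ++ l)

  addBlocks-leadingCounts-dropLeadings : ∀ {r} T (Λ : Tuple r) →
    addBlocks T (leadingCounts T Λ) (dropLeadings T Λ) ≡ Λ
  addBlocks-leadingCounts-dropLeadings T []      = refl
  addBlocks-leadingCounts-dropLeadings T (l ∷ Λ) =
    cong₂ _∷_ (replicate-leadingCount-++-dropLeading T l) (addBlocks-leadingCounts-dropLeadings T Λ)

  leadingCounts-addBlocks : ∀ {r} n (M : Vec ℕ r) {Λ} → PartsAtMost n Λ →
    leadingCounts (suc n) (addBlocks (suc n) M Λ) ≡ M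
  leadingCounts-addBlocks n []      []         = refl
  leadingCounts-addBlocks n (m ∷ M) (l≤n ∷ Λ≤n) =
    cong₂ _∷_ (cong proj₁ (leadingRun-replicate-++ n m l≤n)) (leadingCounts-addBlocks n M Λ≤n)

  dropLeadings-addBlocks : ∀ {r} n (M : Vec ℕ r) {Λ} → PartsAtMost n Λ →
    dropLeadings (suc n) (addBlocks (suc n) M Λ) ≡ Λ
  dropLeadings-addBlocks n []      []         = refl
  dropLeadings-addBlocks n (m ∷ M) (l≤n ∷ Λ≤n) =
    cong₂ _∷_ (cong proj₂ (leadingRun-replicate-++ n m l≤n)) (dropLeadings-addBlocks n M Λ≤n)

  addBlocks-injective : ∀ {r} T (M : Vec ℕ r) {Λ Λ′} → addBlocks T M Λ ≡ addBlocks T M Λ′ → Λ ≡ Λ′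
  addBlocks-injective T []      {[]}    {[]}      _  = refl
  addBlocks-injective T (m ∷ M) {l ∷ Λ} {l′ ∷ Λ′} eq =
    cong₂ _∷_ (++-cancelˡ (replicate m T) l l′ (cong Vec.head eq)) (addBlocks-injective T M (cong Vec.tail eq))

  size-addBlocks : ∀ {r} T (M : Vec ℕ r) Λ → size (addBlocks T M Λ) ≡ Vec.sum M * T + size Λ
  size-addBlocks T []      []      = refl
  size-addBlocks T (m ∷ M) (l ∷ Λ) = begin
    sum (replicate m T ++ l) + size (addBlocks T M Λ)
      ≡⟨ cong₂ _+_ (sum-replicate-++ m T l) (size-addBlocks T M Λ) ⟩
    m * T + sum l + (Vec.sum M * T + size Λ)
      ≡⟨ +-interchange (m * T) (sum l) (Vec.sum M * T) (size Λ) ⟩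
    m * T + Vec.sum M * T + (sum l + size Λ)
      ≡⟨ cong (λ x → x + (sum l + size Λ)) (sym (ℕP.*-distribʳ-+ T m (Vec.sum M))) ⟩
    (m + Vec.sum M) * T + (sum l + size Λ) ∎
    where open ≡-Reasoning

  PartsAtMost-addBlocks : ∀ {r} T (M : Vec ℕ r) {Λ} → PartsAtMost T Λ → PartsAtMost T (addBlocks T M Λ)
  PartsAtMost-addBlocks T []      []           = []
  PartsAtMost-addBlocks T (m ∷ M) (l≤T ∷ Λ≤T) =
    AllP.++⁺ (AllP.replicate⁺ m ℕP.≤-refl) l≤T ∷ PartsAtMost-addBlocks T M Λ≤T

  PartsAtMost-addBlocks⁻ : ∀ {r} T (M : Vec ℕ r) {Λ} → PartsAtMost T (addBlocks T M Λ) → PartsAtMost T Λ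
  PartsAtMost-addBlocks⁻ T []      {[]}    []           = []
  PartsAtMost-addBlocks⁻ T (m ∷ M) {l ∷ Λ} (l≤T ∷ Λ≤T) =
    AllP.++⁻ʳ (replicate m T) l≤T ∷ PartsAtMost-addBlocks⁻ T M Λ≤T

  PartsAtMost-suc : ∀ {r n} {Λ : Tuple r} → PartsAtMost n Λ → PartsAtMost (suc n) Λ
  PartsAtMost-suc = VAll.map (All.map ℕP.m≤n⇒m≤1+n)

  PartsAtMost-dropLeadings : ∀ {r} n {Λ : Tuple r} → PartsAtMost (suc n) Λ → VAll.All IsPartition Λ →
    PartsAtMost n (dropLeadings (suc n) Λ)
  PartsAtMost-dropLeadings n {[]}    []           []                = []
  PartsAtMost-dropLeadings n {l ∷ Λ} (l≤T ∷ Λ≤T) ((_ , dec) ∷ Λp) =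
    dropLeading-≤ n l l≤T dec ∷ PartsAtMost-dropLeadings n Λ≤T Λp

  -- IsCylindric with its r conditions indexed uniformly: the k-th compares components cyclicPred r k and k.
  IsCylindric′ : ∀ {r} → Vec ℕ r → Tuple r → Set
  IsCylindric′ {r} c Λ = VAll.All IsPartition Λ ×
    (∀ k → 1 ≤ k → k ≤ r → Dominates (compN c k) (compL Λ (cyclicPred r k)) (compL Λ k))

  IsCylindric⇒IsCylindric′ : ∀ {r} (c : Vec ℕ r) {Λ} → IsCylindric c Λ → IsCylindric′ c Λ
  IsCylindric⇒IsCylindric′ {r} c {Λ} (parts , within , wrap) = parts , dom
    where
    dom : ∀ k → 1 ≤ k → k ≤ r → Dominates (compN c k) (compL Λ (cyclicPred r k)) (compL Λ k)
    dom (suc zero)    _ _   t = wrap (suc t) (s≤s z≤n)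
    dom (suc (suc i)) _ k≤r t = within (suc i) (suc t) (s≤s z≤n) k≤r (s≤s z≤n)

  IsCylindric′⇒IsCylindric : ∀ {r} (c : Vec ℕ r) {Λ} → 1 ≤ r → IsCylindric′ c Λ → IsCylindric c Λ
  IsCylindric′⇒IsCylindric c 1≤r (parts , dom) =
    parts ,
    (λ { (suc i) (suc t) _ i<r _ → dom (suc (suc i)) (s≤s z≤n) i<r t }) ,
    (λ { (suc t) _ → dom 1 (s≤s z≤n) 1≤r t })

  -- Removing runs of lengths M of the largest part turns the offset c_k into c_k + M_{k-1} - M_k
  -- (Dominates-blocks⁻); admissibility says this is not truncated.
  Admissible : ∀ {r} → Vec ℕ r → Vec ℕ r → Set
  Admissible {r} c M = ∀ k → 1 ≤ k → k ≤ r → compN M k ≤ compN c k + compN M (cyclicPred r k)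

  strippedProfile : ∀ {r} → Vec ℕ r → Vec ℕ r → Vec ℕ r
  strippedProfile {r} c M = tabulateFrom r 1 (λ k → compN c k + compN M (cyclicPred r k) ∸ compN M k)

  compN-strippedProfile : ∀ {r} (c M : Vec ℕ r) k → 1 ≤ k → k ≤ r →
    compN (strippedProfile c M) k ≡ compN c k + compN M (cyclicPred r k) ∸ compN M k
  compN-strippedProfile {r} c M = compN-tabulate r (λ k → compN c k + compN M (cyclicPred r k) ∸ compN M k)

  IsPartitions-addBlocks⁺ : ∀ {r} n (M : Vec ℕ r) {Λ} → PartsAtMost (suc n) Λ → VAll.All IsPartition Λ →
    VAll.All IsPartition (addBlocks (suc n) M Λ)
  IsPartitions-addBlocks⁺ n []      []           []         = []
  IsPartitions-addBlocks⁺ n (m ∷ M) (l≤T ∷ Λ≤T) (p ∷ ps) =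
    IsPartition-replicate-++ m n l≤T p ∷ IsPartitions-addBlocks⁺ n M Λ≤T ps

  IsPartitions-addBlocks⁻ : ∀ {r} T (M : Vec ℕ r) {Λ} → VAll.All IsPartition (addBlocks T M Λ) →
    VAll.All IsPartition Λ
  IsPartitions-addBlocks⁻ T []      {[]}    []       = []
  IsPartitions-addBlocks⁻ T (m ∷ M) {l ∷ Λ} (p ∷ ps) =
    IsPartition-++⁻ʳ (replicate m T) p ∷ IsPartitions-addBlocks⁻ T M ps

  module _ {r : ℕ} (c M : Vec ℕ r) where

    private
      blocks-at : ∀ T {Λ} k → 1 ≤ k → k ≤ r →
        Dominates (compN c k) (compL (addBlocks T M Λ) (cyclicPred r k)) (compL (addBlocks T M Λ) k) ≡
        Dominates (compN c k) (replicate (compN M (cyclicPred r k)) T ++ compL Λ (cyclicPred r k))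
                              (replicate (compN M k) T ++ compL Λ k)
      blocks-at T {Λ} k 1≤k k≤r with cyclicPred-range r k 1≤k k≤r
      ... | 1≤k′ , k′≤r =
        cong₂ (Dominates (compN c k)) (compL-addBlocks T M Λ _ 1≤k′ k′≤r) (compL-addBlocks T M Λ k 1≤k k≤r)

    IsCylindric′-addBlocks⁻ : ∀ T {Λ} → Admissible c M → IsCylindric′ c (addBlocks T M Λ) →
      IsCylindric′ (strippedProfile c M) Λ
    IsCylindric′-addBlocks⁻ T {Λ} adm (parts , dom) = IsPartitions-addBlocks⁻ T M parts , dom′
      where
      dom′ : ∀ k → 1 ≤ k → k ≤ r →
        Dominates (compN (strippedProfile c M) k) (compL Λ (cyclicPred r k)) (compL Λ k)
      dom′ k 1≤k k≤r rewrite compN-strippedProfile c M k 1≤k k≤r =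
        Dominates-blocks⁻ T _ _ _ _ _ (adm k 1≤k k≤r) (subst id (blocks-at T k 1≤k k≤r) (dom k 1≤k k≤r))

    IsCylindric′-addBlocks⁺ : ∀ n {Λ} → Admissible c M → PartsAtMost (suc n) Λ →
      IsCylindric′ (strippedProfile c M) Λ → IsCylindric′ c (addBlocks (suc n) M Λ)
    IsCylindric′-addBlocks⁺ n {Λ} adm Λ≤T (parts , dom) = IsPartitions-addBlocks⁺ n M Λ≤T parts , dom′
      where
      dom′ : ∀ k → 1 ≤ k → k ≤ r →
        Dominates (compN c k) (compL (addBlocks (suc n) M Λ) (cyclicPred r k)) (compL (addBlocks (suc n) M Λ) k)
      dom′ k 1≤k k≤r = subst id (sym (blocks-at (suc n) k 1≤k k≤r))
        (Dominates-blocks⁺ (suc n) _ _ _ _ _ (adm k 1≤k k≤r) (compL-All Λ≤T k 1≤k k≤r)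
          (subst (λ o → Dominates o (compL Λ (cyclicPred r k)) (compL Λ k))
                 (compN-strippedProfile c M k 1≤k k≤r) (dom k 1≤k k≤r)))

    IsCylindric′-addBlocks⇒Admissible : ∀ n {Λ} → PartsAtMost n Λ →
      IsCylindric′ c (addBlocks (suc n) M Λ) → Admissible c M
    IsCylindric′-addBlocks⇒Admissible n Λ≤n (_ , dom) k 1≤k k≤r with cyclicPred-range r k 1≤k k≤r
    ... | 1≤k′ , k′≤r = Dominates-blocks-≤ n _ _ _ _ _ (compL-All Λ≤n _ 1≤k′ k′≤r)
                          (subst id (blocks-at (suc n) k 1≤k k≤r) (dom k 1≤k k≤r))

  -- Profiles of equal level

  partialSum : ℕ → (ℕ → ℕ) → ℕ
  partialSum zero    f = 0
  partialSum (suc k) f = partialSum k f + f (suc k)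

  partialSum-∷ : ∀ {r} k x (v : Vec ℕ r) → partialSum (suc k) (compN (x ∷ v)) ≡ x + partialSum k (compN v)
  partialSum-∷ zero    x v = ℕP.+-comm 0 x
  partialSum-∷ (suc k) x v = trans (cong (_+ compN v (suc k)) (partialSum-∷ k x v)) (ℕP.+-assoc x _ _)

  sum≡partialSum : ∀ {r} (v : Vec ℕ r) → Vec.sum v ≡ partialSum r (compN v)
  sum≡partialSum []               = refl
  sum≡partialSum {suc r} (x ∷ v) = trans (cong (λ s → x + s) (sum≡partialSum v)) (sym (partialSum-∷ r x v))

  +-∸≡- : ∀ {a z} → z ≤ a → + (a ∸ z) ≡ + a - + z
  +-∸≡- {a} {z} z≤a = sym (trans (ℤP.m-n≡m⊖n a z) (ℤP.⊖-≥ z≤a))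

  -≡+⇒≡+ : ∀ a z w → + a - + z ≡ + w → a ≡ w + z
  -≡+⇒≡+ a z w eq = ℤP.+-injective (begin
    + a                    ≡⟨ split (+ a) (+ z) ⟩
    (+ a - + z) ℤ.+ + z    ≡⟨ cong (ℤ._+ + z) eq ⟩
    + (w + z)              ∎)
    where
    open ≡-Reasoning
    split : ∀ x y → x ≡ (x - y) ℤ.+ y
    split = solve-∀

  argmin : ∀ K (f : ℕ → ℤ) →
    Σ ℕ λ k → 1 ≤ k × k ≤ suc K × (∀ j → 1 ≤ j → j ≤ suc K → f k ℤ.≤ f j)
  argmin zero    f = 1 , s≤s z≤n , s≤s z≤n , λ { (suc zero) _ _ → ℤP.≤-refl ; (suc (suc _)) _ (s≤s ()) }
  argmin (suc K) f with argmin K f | ℤP.≤-total (f (proj₁ (argmin K f))) (f (suc (suc K)))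
  ... | k , 1≤k , k≤ , min | inj₁ fk≤ = k , 1≤k , ℕP.m≤n⇒m≤1+n k≤ , min′
    where
    min′ : ∀ j → 1 ≤ j → j ≤ suc (suc K) → f k ℤ.≤ f j
    min′ j 1≤j j≤ with j ≟ suc (suc K)
    ... | yes refl = fk≤
    ... | no j≢    = min j 1≤j (ℕP.≤-pred (ℕP.≤∧≢⇒< j≤ j≢))
  ... | k , 1≤k , k≤ , min | inj₂ f≤fk = suc (suc K) , s≤s z≤n , ℕP.≤-refl , min′
    where
    min′ : ∀ j → 1 ≤ j → j ≤ suc (suc K) → f (suc (suc K)) ℤ.≤ f j
    min′ j 1≤j j≤ with j ≟ suc (suc K)
    ... | yes refl = ℤP.≤-refl
    ... | no j≢    = ℤP.≤-trans f≤fk (min j 1≤j (ℕP.≤-pred (ℕP.≤∧≢⇒< j≤ j≢)))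

  HasZero : ∀ {r} → Vec ℕ r → Set
  HasZero {r} M = Σ ℕ λ k → 1 ≤ k × k ≤ r × compN M k ≡ 0

  AllPositive : ∀ {r} → Vec ℕ r → Set
  AllPositive = VAll.All (1 ≤_)

  ¬AllPositive⇒HasZero : ∀ {r} (M : Vec ℕ r) → ¬ AllPositive M → HasZero M
  ¬AllPositive⇒HasZero []          ¬pos = ⊥-elim (¬pos [])
  ¬AllPositive⇒HasZero (zero  ∷ M) ¬pos = 1 , s≤s z≤n , s≤s z≤n , refl
  ¬AllPositive⇒HasZero (suc x ∷ M) ¬pos with ¬AllPositive⇒HasZero M (λ pos → ¬pos (s≤s z≤n ∷ pos))
  ... | suc k , _ , k≤r , Mk≡0 = suc (suc k) , s≤s z≤n , s≤s k≤r , Mk≡0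

  HasZero⇒¬AllPositive : ∀ {r} (M : Vec ℕ r) → HasZero M → ¬ AllPositive M
  HasZero⇒¬AllPositive M (k , 1≤k , k≤r , Mk≡0) pos =
    ℕP.n≮n 0 (subst (1 ≤_) Mk≡0 (compN-All pos k 1≤k k≤r))

  module ProfileCorrespondence {r′ : ℕ} (c : Vec ℕ (suc r′)) where

    private
      r : ℕ
      r = suc r′

    drift : Vec ℕ r → ℕ → ℤ
    drift p zero    = + 0
    drift p (suc k) = drift p k ℤ.+ (+ compN c (suc k) - + compN p (suc k))

    drift≡partialSums : ∀ p k → drift p k ≡ + partialSum k (compN c) - + partialSum k (compN p)
    drift≡partialSums p zero    = refl
    drift≡partialSums p (suc k) = trans (cong (ℤ._+ (+ compN c (suc k) - + compN p (suc k))) (drift≡partialSums p k))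
      (regroup (+ partialSum k (compN c)) (+ partialSum k (compN p)) (+ compN c (suc k)) (+ compN p (suc k)))
      where
      regroup : ∀ a b x y → (a - b) ℤ.+ (x - y) ≡ (a ℤ.+ x) - (b ℤ.+ y)
      regroup = solve-∀

    drift-level : ∀ p → Vec.sum p ≡ Vec.sum c → drift p r ≡ + 0
    drift-level p p∼c = begin
      drift p r                                             ≡⟨ drift≡partialSums p r ⟩
      + partialSum r (compN c) - + partialSum r (compN p)
        ≡⟨ cong₂ (λ x y → + x - + y) (sym (sum≡partialSum c)) (sym (sum≡partialSum p)) ⟩
      + Vec.sum c - + Vec.sum p                             ≡⟨ cong (λ y → + Vec.sum c - + y) p∼c ⟩
      + Vec.sum c - + Vec.sum c                             ≡⟨ ℤP.+-inverseʳ (+ Vec.sum c) ⟩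
      + 0                                                   ∎
      where open ≡-Reasoning

    -- The runs M solving c_k + M_{k-1} - M_k = p_k are the drifts shifted to have minimum 0.
    lowest : Vec ℕ r → ℕ
    lowest p = proj₁ (argmin r′ (drift p))

    runsFor : Vec ℕ r → Vec ℕ r
    runsFor p = tabulateFrom r 1 (λ k → ∣ drift p k - drift p (lowest p) ∣)

    +-compN-runsFor : ∀ p k → 1 ≤ k → k ≤ r → + compN (runsFor p) k ≡ drift p k - drift p (lowest p)
    +-compN-runsFor p k 1≤k k≤r with argmin r′ (drift p)
    ... | _ , _ , _ , min = trans (cong +_ (compN-tabulate r _ k 1≤k k≤r))
                                  (ℤP.0≤i⇒+∣i∣≡i (ℤP.i≤j⇒0≤j-i (min k 1≤k k≤r)))

    +-compN-runsFor-cyclicPred : ∀ p → Vec.sum p ≡ Vec.sum c → ∀ k → suc k ≤ r →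
      + compN (runsFor p) (cyclicPred r (suc k)) ≡ drift p k - drift p (lowest p)
    +-compN-runsFor-cyclicPred p p∼c zero    _   =
      trans (+-compN-runsFor p r (s≤s z≤n) ℕP.≤-refl) (cong (_- drift p (lowest p)) (drift-level p p∼c))
    +-compN-runsFor-cyclicPred p p∼c (suc k) k<r = +-compN-runsFor p (suc k) (s≤s z≤n) (ℕP.<⇒≤ k<r)

    runsFor-step : ∀ p → Vec.sum p ≡ Vec.sum c → ∀ k → 1 ≤ k → k ≤ r →
      + compN c k ℤ.+ + compN (runsFor p) (cyclicPred r k) - + compN (runsFor p) k ≡ + compN p k
    runsFor-step p p∼c (suc k) 1≤k k<r = begin
      + compN c (suc k) ℤ.+ + compN (runsFor p) (cyclicPred r (suc k)) - + compN (runsFor p) (suc k)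
        ≡⟨ cong₂ (λ x y → + compN c (suc k) ℤ.+ x - y)
                 (+-compN-runsFor-cyclicPred p p∼c k k<r) (+-compN-runsFor p (suc k) 1≤k k<r) ⟩
      + compN c (suc k) ℤ.+ (drift p k - d) - ((drift p k ℤ.+ (+ compN c (suc k) - + compN p (suc k))) - d)
        ≡⟨ cancel (+ compN c (suc k)) (+ compN p (suc k)) (drift p k) d ⟩
      + compN p (suc k) ∎
      where
      open ≡-Reasoning
      d : ℤ
      d = drift p (lowest p)
      cancel : ∀ x y e d → x ℤ.+ (e - d) - ((e ℤ.+ (x - y)) - d) ≡ y
      cancel = solve-∀

    runsFor-admissible : ∀ p → Vec.sum p ≡ Vec.sum c → Admissible c (runsFor p)
    runsFor-admissible p p∼c k 1≤k k≤r =
      subst (compN (runsFor p) k ≤_) (sym (-≡+⇒≡+ _ _ _ (runsFor-step p p∼c k 1≤k k≤r))) (ℕP.m≤n+m _ _)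

    strippedProfile-runsFor : ∀ p → Vec.sum p ≡ Vec.sum c → strippedProfile c (runsFor p) ≡ p
    strippedProfile-runsFor p p∼c = compN-ext _ _ λ k 1≤k k≤r →
      trans (compN-strippedProfile c (runsFor p) k 1≤k k≤r)
            (trans (cong (_∸ compN (runsFor p) k) (-≡+⇒≡+ _ _ _ (runsFor-step p p∼c k 1≤k k≤r)))
                   (ℕP.m+n∸n≡m (compN p k) (compN (runsFor p) k)))

    runsFor-hasZero : ∀ p → HasZero (runsFor p)
    runsFor-hasZero p = lowest p , 1≤k , k≤r ,
      ℤP.+-injective (trans (+-compN-runsFor p (lowest p) 1≤k k≤r) (ℤP.+-inverseʳ (drift p (lowest p))))
      where
      1≤k : 1 ≤ lowest p
      1≤k = proj₁ (proj₂ (argmin r′ (drift p)))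
      k≤r : lowest p ≤ r
      k≤r = proj₁ (proj₂ (proj₂ (argmin r′ (drift p))))

    module _ (M : Vec ℕ r) (adm : Admissible c M) where

      private
        p : Vec ℕ r
        p = strippedProfile c M

      +-compN-strippedProfile : ∀ k → 1 ≤ k → k ≤ r →
        + compN p k ≡ + compN c k ℤ.+ + compN M (cyclicPred r k) - + compN M k
      +-compN-strippedProfile k 1≤k k≤r =
        trans (cong +_ (compN-strippedProfile c M k 1≤k k≤r)) (+-∸≡- (adm k 1≤k k≤r))

      drift-strippedProfile : ∀ k → k ≤ r → drift p k ≡ + compN M (cyclicPred r (suc k)) - + compN M r
      drift-strippedProfile zero    _   = sym (ℤP.+-inverseʳ (+ compN M r))
      drift-strippedProfile (suc k) k<r =
        trans (cong₂ (λ e x → e ℤ.+ (+ compN c (suc k) - x))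
                     (drift-strippedProfile k (ℕP.<⇒≤ k<r)) (+-compN-strippedProfile (suc k) (s≤s z≤n) k<r))
              (telescope (+ compN c (suc k)) (+ compN M (cyclicPred r (suc k))) (+ compN M (suc k)) (+ compN M r))
        where
        telescope : ∀ x m′ mₖ mᵣ → (m′ - mᵣ) ℤ.+ (x - ((x ℤ.+ m′) - mₖ)) ≡ mₖ - mᵣ
        telescope = solve-∀

      drift-strippedProfile⁺ : ∀ k → 1 ≤ k → k ≤ r → drift p k ≡ + compN M k - + compN M r
      drift-strippedProfile⁺ (suc k) _ k<r = drift-strippedProfile (suc k) k<r

      level-strippedProfile : Vec.sum p ≡ Vec.sum c
      level-strippedProfile = begin
        Vec.sum p                  ≡⟨ sum≡partialSum p ⟩
        partialSum r (compN p)     ≡⟨ ℤP.+-injective (sym (ℤP.i-j≡0⇒i≡j _ _ drift-r≡0)) ⟩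
        partialSum r (compN c)     ≡⟨ sym (sum≡partialSum c) ⟩
        Vec.sum c                  ∎
        where
        open ≡-Reasoning
        drift-r≡0 : + partialSum r (compN c) - + partialSum r (compN p) ≡ + 0
        drift-r≡0 = trans (sym (drift≡partialSums p r))
                          (trans (drift-strippedProfile r ℕP.≤-refl) (ℤP.+-inverseʳ (+ compN M r)))

      runsFor-strippedProfile : HasZero M → runsFor p ≡ M
      runsFor-strippedProfile (k₀ , 1≤k₀ , k₀≤r , Mk₀≡0) = compN-ext _ _ λ k 1≤k k≤r →
        ℤP.+-injective (begin
          + compN (runsFor p) k
            ≡⟨ +-compN-runsFor p k 1≤k k≤r ⟩
          drift p k - drift p (lowest p)
            ≡⟨ cong₂ _-_ (drift-strippedProfile⁺ k 1≤k k≤r) lowest-drift ⟩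
          (+ compN M k - + compN M r) - (+ 0 - + compN M r)
            ≡⟨ cancel (+ compN M k) (+ compN M r) ⟩
          + compN M k ∎)
        where
        open ≡-Reasoning
        cancel : ∀ m x → (m - x) - (+ 0 - x) ≡ m
        cancel = solve-∀
        lowest-drift : drift p (lowest p) ≡ + 0 - + compN M r
        lowest-drift with argmin r′ (drift p)
        ... | k , 1≤k , k≤r , min = ℤP.≤-antisym below above
          where
          below : drift p k ℤ.≤ + 0 - + compN M r
          below = ℤP.≤-trans (min k₀ 1≤k₀ k₀≤r)
                    (ℤP.≤-reflexive (trans (drift-strippedProfile⁺ k₀ 1≤k₀ k₀≤r)
                                           (cong (λ m → + m - + compN M r) Mk₀≡0)))
          above : + 0 - + compN M r ℤ.≤ drift p k
          above = ℤP.≤-trans (ℤP.+-monoˡ-≤ (ℤ.- + compN M r) (ℤ.+≤+ z≤n))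
                    (ℤP.≤-reflexive (sym (drift-strippedProfile⁺ k 1≤k k≤r)))

  incrementHead : ∀ {r} → Vec ℕ (suc r) → Vec ℕ (suc r)
  incrementHead (x ∷ v) = suc x ∷ v

  compositions : (r ℓ : ℕ) → List (Vec ℕ r)
  compositions zero    zero    = [] ∷ []
  compositions zero    (suc ℓ) = []
  compositions (suc r) zero    = map (0 ∷_) (compositions r 0)
  compositions (suc r) (suc ℓ) =
    map (0 ∷_) (compositions r (suc ℓ)) ++ map incrementHead (compositions (suc r) ℓ)

  ∈-compositions⁻ : ∀ r ℓ {v} → v ∈ compositions r ℓ → Vec.sum v ≡ ℓ
  ∈-compositions⁻ zero    zero    (here refl) = refl
  ∈-compositions⁻ (suc r) zero    v∈ with ∈-map⁻ (0 ∷_) v∈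
  ... | _ , w∈ , refl = ∈-compositions⁻ r 0 w∈
  ∈-compositions⁻ (suc r) (suc ℓ) v∈ with ∈-++⁻ (map (0 ∷_) (compositions r (suc ℓ))) v∈
  ... | inj₁ v∈₀ with ∈-map⁻ (0 ∷_) v∈₀
  ...   | _ , w∈ , refl = ∈-compositions⁻ r (suc ℓ) w∈
  ∈-compositions⁻ (suc r) (suc ℓ) v∈ | inj₂ v∈₁ with ∈-map⁻ incrementHead v∈₁
  ...   | _ ∷ _ , w∈ , refl = cong suc (∈-compositions⁻ (suc r) ℓ w∈)

  ∈-compositions⁺ : ∀ r ℓ (v : Vec ℕ r) → Vec.sum v ≡ ℓ → v ∈ compositions r ℓ
  ∈-compositions⁺ zero    zero    []          _  = here refl
  ∈-compositions⁺ (suc r) zero    (zero ∷ w)  eq = ∈-map⁺ (0 ∷_) (∈-compositions⁺ r 0 w eq)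
  ∈-compositions⁺ (suc r) (suc ℓ) (zero ∷ w)  eq =
    ∈-++⁺ˡ (∈-map⁺ (0 ∷_) (∈-compositions⁺ r (suc ℓ) w eq))
  ∈-compositions⁺ (suc r) (suc ℓ) (suc x ∷ w) eq = ∈-++⁺ʳ (map (0 ∷_) (compositions r (suc ℓ)))
    (∈-map⁺ incrementHead (∈-compositions⁺ (suc r) ℓ (x ∷ w) (ℕP.suc-injective eq)))

  compositions-unique : ∀ r ℓ → Unique (compositions r ℓ)
  compositions-unique zero    zero    = [] ∷ []
  compositions-unique zero    (suc ℓ) = []
  compositions-unique (suc r) zero    = UniqueP.map⁺ (λ { refl → refl }) (compositions-unique r 0)
  compositions-unique (suc r) (suc ℓ) =
    UniqueP.++⁺ (UniqueP.map⁺ (λ { refl → refl }) (compositions-unique r (suc ℓ)))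
                (UniqueP.map⁺ incrementHead-injective (compositions-unique (suc r) ℓ))
                disjoint
    where
    incrementHead-injective : ∀ {x y : Vec ℕ (suc r)} → incrementHead x ≡ incrementHead y → x ≡ y
    incrementHead-injective {_ ∷ _} {_ ∷ _} refl = refl
    disjoint : ∀ {v} →
      v ∈ map (0 ∷_) (compositions r (suc ℓ)) × v ∈ map incrementHead (compositions (suc r) ℓ) → ⊥
    disjoint (v∈₀ , v∈₁) with ∈-map⁻ (0 ∷_) v∈₀ | ∈-map⁻ incrementHead v∈₁
    ... | _ , _ , refl | _ ∷ _ , _ , ()

  profileCount : ℕ → ℕ → ℕ
  profileCount r ℓ = (ℓ + r ∸ 1) C (r ∸ 1)

  length-compositions : ∀ r ℓ → length (compositions (suc r) ℓ) ≡ (ℓ + r) C r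
  length-compositions zero    zero    = refl
  length-compositions zero    (suc ℓ) =
    trans (length-map-++-map (0 ∷_) incrementHead (compositions 0 (suc ℓ)) (compositions 1 ℓ))
          (length-compositions zero ℓ)
  length-compositions (suc r) zero    =
    trans (length-map (0 ∷_) (compositions (suc r) 0))
          (trans (length-compositions r 0) (trans (nCn≡1 r) (sym (nCn≡1 (suc r)))))
  length-compositions (suc r) (suc ℓ) = begin
    length (map (0 ∷_) (compositions (suc r) (suc ℓ)) ++ map incrementHead (compositions (suc (suc r)) ℓ))
      ≡⟨ length-map-++-map (0 ∷_) incrementHead (compositions (suc r) (suc ℓ)) (compositions (suc (suc r)) ℓ) ⟩
    length (compositions (suc r) (suc ℓ)) + length (compositions (suc (suc r)) ℓ)
      ≡⟨ cong₂ _+_ (length-compositions r (suc ℓ)) (length-compositions (suc r) ℓ) ⟩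
    (suc ℓ + r) C r + (ℓ + suc r) C suc r
      ≡⟨ cong (λ n → n C r + (ℓ + suc r) C suc r) (sym (ℕP.+-suc ℓ r)) ⟩
    (ℓ + suc r) C r + (ℓ + suc r) C suc r
      ≡⟨ nCk+nC[k+1]≡[n+1]C[k+1] (ℓ + suc r) r ⟩
    (suc ℓ + suc r) C suc r ∎
    where open ≡-Reasoning

  -- The recurrence obtained by removing the runs of the largest part

  ones : ∀ r → Vec ℕ r
  ones r = Vec.replicate r 1

  compN-replicate : ∀ r x k → 1 ≤ k → k ≤ r → compN (Vec.replicate r x) k ≡ x
  compN-replicate (suc r) x (suc zero)    _ _         = refl
  compN-replicate (suc r) x (suc (suc k)) _ (s≤s k≤r) = compN-replicate r x (suc k) (s≤s z≤n) k≤r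

  sum-ones : ∀ r → Vec.sum (ones r) ≡ r
  sum-ones zero    = refl
  sum-ones (suc r) = cong suc (sum-ones r)

  admissible-replicate : ∀ {r} (c : Vec ℕ r) x → Admissible c (Vec.replicate r x)
  admissible-replicate {r} c x k 1≤k k≤r with cyclicPred-range r k 1≤k k≤r
  ... | 1≤k′ , k′≤r
    rewrite compN-replicate r x k 1≤k k≤r | compN-replicate r x (cyclicPred r k) 1≤k′ k′≤r =
    ℕP.m≤n+m x (compN c k)

  strippedProfile-replicate : ∀ {r} (c : Vec ℕ r) x → strippedProfile c (Vec.replicate r x) ≡ c
  strippedProfile-replicate {r} c x = compN-ext _ _ λ k 1≤k k≤r →
    let (1≤k′ , k′≤r) = cyclicPred-range r k 1≤k k≤r in begin
    compN (strippedProfile c (Vec.replicate r x)) k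
      ≡⟨ compN-strippedProfile c (Vec.replicate r x) k 1≤k k≤r ⟩
    compN c k + compN (Vec.replicate r x) (cyclicPred r k) ∸ compN (Vec.replicate r x) k
      ≡⟨ cong₂ (λ y z → compN c k + y ∸ z)
               (compN-replicate r x _ 1≤k′ k′≤r) (compN-replicate r x k 1≤k k≤r) ⟩
    compN c k + x ∸ x
      ≡⟨ ℕP.m+n∸n≡m (compN c k) x ⟩
    compN c k ∎
    where open ≡-Reasoning

  size-addBlocks-ones : ∀ {r} T (Λ : Tuple r) → size (addBlocks T (ones r) Λ) ≡ r * T + size Λ
  size-addBlocks-ones {r} T Λ = trans (size-addBlocks T (ones r) Λ) (cong (λ s → s * T + size Λ) (sum-ones r))

  allPositive-leadingCounts-ones : ∀ {r} T (Λ : Tuple r) → AllPositive (leadingCounts T (addBlocks T (ones r) Λ))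
  allPositive-leadingCounts-ones T []      = []
  allPositive-leadingCounts-ones T (l ∷ Λ) with T ≟ T
  ... | yes _   = s≤s z≤n ∷ allPositive-leadingCounts-ones T Λ
  ... | no T≢T = contradiction refl T≢T

  leadingCount-positive : ∀ T l → 1 ≤ leadingCount T l → l ≡ T ∷ List.drop 1 l
  leadingCount-positive T []       ()
  leadingCount-positive T (x ∷ xs) 1≤count with x ≟ T
  ... | yes refl = refl
  leadingCount-positive T (x ∷ xs) () | no _

  addBlocks-ones-drop : ∀ {r} T (Λ : Tuple r) → AllPositive (leadingCounts T Λ) →
    Λ ≡ addBlocks T (ones r) (Vec.map (List.drop 1) Λ)
  addBlocks-ones-drop T []      []             = refl
  addBlocks-ones-drop T (l ∷ Λ) (1≤count ∷ pos) =
    cong₂ _∷_ (leadingCount-positive T l 1≤count) (addBlocks-ones-drop T Λ pos)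

  module Recurrence {r′ : ℕ} (n : ℕ) (c : Vec ℕ (suc r′))
    (L : ℕ → List (Tuple (suc r′))) (L-enum : ∀ m → Enumerates c (suc n) m (L m)) where

    open ProfileCorrespondence c

    private
      r : ℕ
      r = suc r′
      T : ℕ
      T = suc n

    L-sound : ∀ {m Λ} → Λ ∈ L m → IsCylindric c Λ × PartsAtMost T Λ × size Λ ≡ m
    L-sound {m} {Λ} = proj₁ (proj₂ (L-enum m) Λ)

    L-complete : ∀ {m Λ} → IsCylindric c Λ × PartsAtMost T Λ × size Λ ≡ m → Λ ∈ L m
    L-complete {m} {Λ} = proj₂ (proj₂ (L-enum m) Λ)

    weight : Vec ℕ r → ℕ
    weight M = Vec.sum M * T

    addBlocks-∈L⁺ : ∀ {M Λ s} → Admissible c M → IsCylindric (strippedProfile c M) Λ → PartsAtMost T Λ →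
      size Λ ≡ s → addBlocks T M Λ ∈ L (weight M + s)
    addBlocks-∈L⁺ {M} {Λ} adm cyl Λ≤T refl = L-complete
      (IsCylindric′⇒IsCylindric c (s≤s z≤n)
         (IsCylindric′-addBlocks⁺ c M n adm Λ≤T (IsCylindric⇒IsCylindric′ (strippedProfile c M) cyl)) ,
       PartsAtMost-addBlocks T M Λ≤T ,
       size-addBlocks T M Λ)

    addBlocks-∈L⁻ : ∀ {M Λ m} → Admissible c M → addBlocks T M Λ ∈ L m →
      IsCylindric (strippedProfile c M) Λ × PartsAtMost T Λ × weight M + size Λ ≡ m
    addBlocks-∈L⁻ {M} {Λ} adm Λ⁺∈ with L-sound Λ⁺∈
    ... | cyl , Λ⁺≤T , size≡m =
      IsCylindric′⇒IsCylindric (strippedProfile c M) (s≤s z≤n)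
        (IsCylindric′-addBlocks⁻ c M T adm (IsCylindric⇒IsCylindric′ c cyl)) ,
      PartsAtMost-addBlocks⁻ T M Λ⁺≤T ,
      trans (sym (size-addBlocks T M Λ)) size≡m

    dropLeadings-≤n : ∀ {m Λ} → Λ ∈ L m → PartsAtMost n (dropLeadings T Λ)
    dropLeadings-≤n Λ∈ with L-sound Λ∈
    ... | (parts , _) , Λ≤T , _ = PartsAtMost-dropLeadings n Λ≤T parts

    leadingCounts-admissible : ∀ {m Λ} → Λ ∈ L m → Admissible c (leadingCounts T Λ)
    leadingCounts-admissible {Λ = Λ} Λ∈ =
      IsCylindric′-addBlocks⇒Admissible c (leadingCounts T Λ) n (dropLeadings-≤n Λ∈)
        (subst (IsCylindric′ c) (sym (addBlocks-leadingCounts-dropLeadings T Λ))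
               (IsCylindric⇒IsCylindric′ c (proj₁ (L-sound Λ∈))))

    -- The admissible run vectors with a zero entry, parametrised by their stripped profiles.
    runs : List (Vec ℕ r)
    runs = map runsFor (compositions r (level c))

    runs-unique : Unique runs
    runs-unique = map⁺-injectiveOn runsFor (compositions-unique r (level c)) λ {p} {q} p∈ q∈ eq →
      trans (sym (strippedProfile-runsFor p (∈-compositions⁻ r _ p∈)))
            (trans (cong (strippedProfile c) eq) (strippedProfile-runsFor q (∈-compositions⁻ r _ q∈)))

    module _ {M : Vec ℕ r} (M∈ : M ∈ runs) where

      private
        origin : Σ (Vec ℕ r) λ p → p ∈ compositions r (level c) × M ≡ runsFor p
        origin with ∈-map⁻ runsFor M∈
        ... | p , p∈ , eq = p , p∈ , eq

      runs-admissible : Admissible c M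
      runs-admissible with origin
      ... | p , p∈ , refl = runsFor-admissible p (∈-compositions⁻ r _ p∈)

      runs-hasZero : HasZero M
      runs-hasZero with origin
      ... | p , _ , refl = runsFor-hasZero p

      runs-level : level (strippedProfile c M) ≡ level c
      runs-level with origin
      ... | p , p∈ , refl =
        trans (cong Vec.sum (strippedProfile-runsFor p (∈-compositions⁻ r _ p∈))) (∈-compositions⁻ r _ p∈)

    length-runs : length runs ≡ profileCount r (level c)
    length-runs =
      trans (length-map runsFor (compositions r (level c)))
            (trans (length-compositions r′ (level c)) (cong (_C r′) (sym (ℕP.+-∸-assoc (level c) (s≤s z≤n)))))

    allPositive? : (Λ : Tuple r) → Dec (AllPositive (leadingCounts T Λ))
    allPositive? Λ = VAll.all? (λ x → 1 ≤? x) (leadingCounts T Λ)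

    hasZero? : (Λ : Tuple r) → Dec (¬ AllPositive (leadingCounts T Λ))
    hasZero? Λ = ¬? (allPositive? Λ)

    _≟V_ : DecidableEquality (Vec ℕ r)
    _≟V_ = VecP.≡-dec _≟_

    open Fibres (leadingCounts {r} T) _≟V_

    leadingCounts-∈-runs : ∀ {m Λ} → Λ ∈ L m → ¬ AllPositive (leadingCounts T Λ) →
      leadingCounts T Λ ∈ runs
    leadingCounts-∈-runs {Λ = Λ} Λ∈ ¬pos =
      subst (_∈ runs) (runsFor-strippedProfile M adm (¬AllPositive⇒HasZero M ¬pos))
        (∈-map⁺ runsFor (∈-compositions⁺ r _ _ (level-strippedProfile M adm)))
      where
      M : Vec ℕ r
      M = leadingCounts T Λ
      adm : Admissible c M
      adm = leadingCounts-admissible Λ∈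

    withRuns : Vec ℕ r → ℕ → List (Tuple r)
    withRuns M m = fibre M (filter hasZero? (L m))

    ∈-withRuns⁻ : ∀ {M m Λ} → Λ ∈ withRuns M m → Λ ∈ L m × Λ ≡ addBlocks T M (dropLeadings T Λ)
    ∈-withRuns⁻ {M} {m} {Λ} Λ∈ with ∈-filter⁻ (λ x → leadingCounts T x ≟V M) Λ∈
    ... | Λ∈′ , counts≡M = proj₁ (∈-filter⁻ hasZero? Λ∈′) ,
      trans (sym (addBlocks-leadingCounts-dropLeadings T Λ))
            (cong (λ M′ → addBlocks T M′ (dropLeadings T Λ)) counts≡M)

    stripped : Vec ℕ r → ℕ → List (Tuple r)
    stripped M s = map (dropLeadings T) (withRuns M (weight M + s))

    stripped-enumerates : ∀ {M} → M ∈ runs → ∀ s → Enumerates (strippedProfile c M) n s (stripped M s)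
    stripped-enumerates {M} M∈ s = unique , λ Λ′ → sound Λ′ , complete Λ′
      where
      unique : Unique (stripped M s)
      unique = map⁺-injectiveOn (dropLeadings T) (UniqueP.filter⁺ _ (UniqueP.filter⁺ hasZero? (proj₁ (L-enum _))))
        λ Λ₁∈ Λ₂∈ eq →
          trans (proj₂ (∈-withRuns⁻ Λ₁∈)) (trans (cong (addBlocks T M) eq) (sym (proj₂ (∈-withRuns⁻ Λ₂∈))))
      sound : ∀ Λ′ → Λ′ ∈ stripped M s →
        IsCylindric (strippedProfile c M) Λ′ × PartsAtMost n Λ′ × size Λ′ ≡ s
      sound Λ′ Λ′∈ with ∈-map⁻ (dropLeadings T) Λ′∈
      ... | Λ , Λ∈ , refl with ∈-withRuns⁻ Λ∈
      ...   | Λ∈L , Λ≡ with addBlocks-∈L⁻ (runs-admissible M∈) (subst (_∈ L (weight M + s)) Λ≡ Λ∈L)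
      ...     | cyl , _ , size≡ = cyl , dropLeadings-≤n Λ∈L , ℕP.+-cancelˡ-≡ (weight M) _ _ size≡
      complete : ∀ Λ′ → IsCylindric (strippedProfile c M) Λ′ × PartsAtMost n Λ′ × size Λ′ ≡ s →
        Λ′ ∈ stripped M s
      complete Λ′ (cyl , Λ′≤n , size≡s) =
        subst (_∈ stripped M s) (dropLeadings-addBlocks n M Λ′≤n)
          (∈-map⁺ (dropLeadings T) (∈-filter⁺ _ (∈-filter⁺ hasZero? Λ∈L noPositive) counts≡M))
        where
        Λ∈L : addBlocks T M Λ′ ∈ L (weight M + s)
        Λ∈L = addBlocks-∈L⁺ (runs-admissible M∈) cyl (PartsAtMost-suc Λ′≤n) size≡s
        counts≡M : leadingCounts T (addBlocks T M Λ′) ≡ M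
        counts≡M = leadingCounts-addBlocks n M Λ′≤n
        noPositive : ¬ AllPositive (leadingCounts T (addBlocks T M Λ′))
        noPositive = HasZero⇒¬AllPositive _ (subst HasZero (sym counts≡M) (runs-hasZero M∈))

    count : Series
    count m = + length (L m)

    countStripped : Vec ℕ r → Series
    countStripped M m = + length (stripped M m)

    addBlocks-ones-∈L⁺ : ∀ {Λ m} → Λ ∈ L m → addBlocks T (ones r) Λ ∈ L (r * T + m)
    addBlocks-ones-∈L⁺ {Λ} {m} Λ∈ with L-sound Λ∈
    ... | cyl , Λ≤T , size≡m =
      L-complete (IsCylindric′⇒IsCylindric c (s≤s z≤n) cyl′ ,
                  PartsAtMost-addBlocks T (ones r) Λ≤T ,
                  trans (size-addBlocks-ones T Λ) (cong (λ x → r * T + x) size≡m))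
      where
      cyl′ : IsCylindric′ c (addBlocks T (ones r) Λ)
      cyl′ = IsCylindric′-addBlocks⁺ c (ones r) n (admissible-replicate c 1) Λ≤T
               (subst (λ c′ → IsCylindric′ c′ Λ) (sym (strippedProfile-replicate c 1))
                      (IsCylindric⇒IsCylindric′ c cyl))

    addBlocks-ones-∈L⁻ : ∀ {Λ m} → addBlocks T (ones r) Λ ∈ L m → r * T ≤ m × Λ ∈ L (m ∸ r * T)
    addBlocks-ones-∈L⁻ {Λ} {m} Λ⁺∈ with L-sound Λ⁺∈
    ... | cyl , Λ⁺≤T , size≡m =
      subst (r * T ≤_) rT+size≡m (ℕP.m≤m+n (r * T) (size Λ)) ,
      L-complete (IsCylindric′⇒IsCylindric c (s≤s z≤n) cyl′ ,
                  PartsAtMost-addBlocks⁻ T (ones r) Λ⁺≤T ,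
                  trans (sym (ℕP.m+n∸m≡n (r * T) (size Λ))) (cong (_∸ r * T) rT+size≡m))
      where
      rT+size≡m : r * T + size Λ ≡ m
      rT+size≡m = trans (sym (size-addBlocks-ones T Λ)) size≡m
      cyl′ : IsCylindric′ c Λ
      cyl′ = subst (λ c′ → IsCylindric′ c′ Λ) (strippedProfile-replicate c 1)
               (IsCylindric′-addBlocks⁻ c (ones r) T (admissible-replicate c 1) (IsCylindric⇒IsCylindric′ c cyl))

    allPositive⇒addBlocks-ones : ∀ {m Λ} → Λ ∈ filter allPositive? (L m) →
      Σ (Tuple r) λ Λ′ → Λ ≡ addBlocks T (ones r) Λ′ × r * T ≤ m × Λ′ ∈ L (m ∸ r * T)
    allPositive⇒addBlocks-ones {m} {Λ} Λ∈ with ∈-filter⁻ allPositive? Λ∈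
    ... | Λ∈L , pos = Vec.map (List.drop 1) Λ , Λ≡ , addBlocks-ones-∈L⁻ (subst (_∈ L m) Λ≡ Λ∈L)
      where
      Λ≡ : Λ ≡ addBlocks T (ones r) (Vec.map (List.drop 1) Λ)
      Λ≡ = addBlocks-ones-drop T Λ pos

    length-allPositive : ∀ s → shift (r * T) count s ≡ + length (filter allPositive? (L s))
    length-allPositive s with r * T ≤? s
    ... | yes rT≤s = trans (shift-≤ count rT≤s) (cong +_ (begin
      length (L (s ∸ r * T))
        ≡⟨ sym (length-map (addBlocks T (ones r)) (L (s ∸ r * T))) ⟩
      length (map (addBlocks T (ones r)) (L (s ∸ r * T)))
        ≡⟨ length-unique-∼set unique-addBlocks (UniqueP.filter⁺ allPositive? (proj₁ (L-enum s))) (mk⇔ to from) ⟩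
      length (filter allPositive? (L s)) ∎))
      where
      open ≡-Reasoning
      unique-addBlocks : Unique (map (addBlocks T (ones r)) (L (s ∸ r * T)))
      unique-addBlocks = UniqueP.map⁺ (addBlocks-injective T (ones r)) (proj₁ (L-enum (s ∸ r * T)))
      to : ∀ {Λ} → Λ ∈ map (addBlocks T (ones r)) (L (s ∸ r * T)) → Λ ∈ filter allPositive? (L s)
      to Λ∈ with ∈-map⁻ (addBlocks T (ones r)) Λ∈
      ... | Λ′ , Λ′∈ , refl = ∈-filter⁺ allPositive?
        (subst (λ m → addBlocks T (ones r) Λ′ ∈ L m) (ℕP.m+[n∸m]≡n rT≤s) (addBlocks-ones-∈L⁺ Λ′∈))
        (allPositive-leadingCounts-ones T Λ′)
      from : ∀ {Λ} → Λ ∈ filter allPositive? (L s) → Λ ∈ map (addBlocks T (ones r)) (L (s ∸ r * T))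
      from Λ∈ with allPositive⇒addBlocks-ones Λ∈
      ... | Λ′ , refl , _ , Λ′∈ = ∈-map⁺ (addBlocks T (ones r)) Λ′∈
    ... | no rT≰s = trans (shift-< count (ℕP.≰⇒> rT≰s))
      (cong +_ (sym (length-empty _ λ Λ∈ → let (_ , _ , rT≤s , _) = allPositive⇒addBlocks-ones Λ∈ in rT≰s rT≤s)))

    length-withRuns : ∀ {M} s → + length (withRuns M s) ≡ shift (weight M) (countStripped M) s
    length-withRuns {M} s with weight M ≤? s
    ... | yes w≤s = sym (trans (shift-≤ (countStripped M) w≤s) (cong +_ (begin
      length (map (dropLeadings T) (withRuns M (weight M + (s ∸ weight M))))
        ≡⟨ length-map (dropLeadings T) (withRuns M (weight M + (s ∸ weight M))) ⟩
      length (withRuns M (weight M + (s ∸ weight M)))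
        ≡⟨ cong (length ∘ withRuns M) (ℕP.m+[n∸m]≡n w≤s) ⟩
      length (withRuns M s) ∎)))
      where open ≡-Reasoning
    ... | no w≰s = trans (cong +_ (length-empty _ too-small)) (sym (shift-< (countStripped M) (ℕP.≰⇒> w≰s)))
      where
      too-small : ∀ {Λ} → Λ ∉ withRuns M s
      too-small Λ∈ with ∈-withRuns⁻ Λ∈
      ... | Λ∈L , Λ≡ = w≰s (ℕP.≤-trans (ℕP.m≤m+n (weight M) _)
                              (ℕP.≤-reflexive (trans (sym (size-addBlocks T M (dropLeadings T _)))
                                                     (trans (cong size (sym Λ≡)) (proj₂ (proj₂ (L-sound Λ∈L)))))))

    length-hasZero : ∀ s →
      + length (filter hasZero? (L s)) ≡ sumSeries runs (λ M → shift (weight M) (countStripped M)) s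
    length-hasZero s = trans
      (cong +_ (length-≡-sum-fibres runs runs-unique (filter hasZero? (L s)) λ Λ∈ →
         let (Λ∈L , ¬pos) = ∈-filter⁻ hasZero? Λ∈ in leadingCounts-∈-runs Λ∈L ¬pos))
      (+-sum≡sumSeries runs _ _ s (λ {M} _ → length-withRuns {M} s))

    count-recurrence : ∀ s →
      oneMinusTimes (r * T) count s ≡ sumSeries runs (λ M → shift (weight M) (countStripped M)) s
    count-recurrence s = begin
      count s - shift (r * T) count s
        ≡⟨ cong₂ _-_ (cong +_ (length-filter-∁ allPositive? (L s))) (length-allPositive s) ⟩
      (+ length (filter allPositive? (L s)) ℤ.+ + length (filter hasZero? (L s))) - + length (filter allPositive? (L s))
        ≡⟨ cancel (+ length (filter allPositive? (L s))) (+ length (filter hasZero? (L s))) ⟩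
      + length (filter hasZero? (L s))
        ≡⟨ length-hasZero s ⟩
      sumSeries runs (λ M → shift (weight M) (countStripped M)) s ∎
      where
      open ≡-Reasoning
      cancel : ∀ x y → (x ℤ.+ y) - x ≡ y
      cancel = solve-∀

    pochTimes-recurrence : ∀ s →
      pochTimes r (suc n) count s ≡ sumSeries runs (λ M → shift (weight M) (pochTimes r n (countStripped M))) s
    pochTimes-recurrence s = begin
      oneMinusTimes (r * T) (pochTimes r n count) s
        ≡⟨ sym (pochTimes-oneMinusTimes r n (r * T) count s) ⟩
      pochTimes r n (oneMinusTimes (r * T) count) s
        ≡⟨ pochTimes-cong r n count-recurrence s ⟩
      pochTimes r n (sumSeries runs (λ M → shift (weight M) (countStripped M))) s
        ≡⟨ pochTimes-sumSeries r n runs _ s ⟩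
      sumSeries runs (λ M → pochTimes r n (shift (weight M) (countStripped M))) s
        ≡⟨ sumSeries-cong runs (λ {M} _ → pochTimes-shift r n (weight M) (countStripped M)) s ⟩
      sumSeries runs (λ M → shift (weight M) (pochTimes r n (countStripped M))) s ∎
      where open ≡-Reasoning

  -- Induction on the bound on the parts

  emptyTuple : ∀ r → Tuple r
  emptyTuple r = Vec.replicate r []

  PartsAtMost-0⇒emptyTuple : ∀ {r} {Λ : Tuple r} → PartsAtMost 0 Λ → VAll.All IsPartition Λ →
    Λ ≡ emptyTuple r
  PartsAtMost-0⇒emptyTuple {Λ = []}          []              []                    = refl
  PartsAtMost-0⇒emptyTuple {Λ = [] ∷ Λ}      (_ ∷ Λ≤0)       (_ ∷ Λp)              =
    cong ([] ∷_) (PartsAtMost-0⇒emptyTuple Λ≤0 Λp)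
  PartsAtMost-0⇒emptyTuple {Λ = (x ∷ _) ∷ _} ((x≤0 ∷ _) ∷ _) (((1≤x ∷ _) , _) ∷ _) =
    contradiction (ℕP.≤-trans 1≤x x≤0) (ℕP.n≮n 0)

  size-emptyTuple : ∀ r → size (emptyTuple r) ≡ 0
  size-emptyTuple zero    = refl
  size-emptyTuple (suc r) = size-emptyTuple r

  PartsAtMost-emptyTuple : ∀ r n → PartsAtMost n (emptyTuple r)
  PartsAtMost-emptyTuple zero    n = []
  PartsAtMost-emptyTuple (suc r) n = [] ∷ PartsAtMost-emptyTuple r n

  compL-emptyTuple : ∀ r k → compL (emptyTuple r) k ≡ []
  compL-emptyTuple zero    k             = refl
  compL-emptyTuple (suc r) zero          = refl
  compL-emptyTuple (suc r) (suc zero)    = refl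
  compL-emptyTuple (suc r) (suc (suc k)) = compL-emptyTuple r (suc k)

  IsCylindric-emptyTuple : ∀ {r} (c : Vec ℕ r) → 1 ≤ r → IsCylindric c (emptyTuple r)
  IsCylindric-emptyTuple {r} c 1≤r = IsCylindric′⇒IsCylindric c 1≤r (partitions r , dom)
    where
    partitions : ∀ r → VAll.All IsPartition (emptyTuple r)
    partitions zero    = []
    partitions (suc r) = ([] , []) ∷ partitions r
    dom : ∀ k → 1 ≤ k → k ≤ r →
      Dominates (compN c k) (compL (emptyTuple r) (cyclicPred r k)) (compL (emptyTuple r) k)
    dom k _ _ i rewrite compL-emptyTuple r k = z≤n

  nonNegPoly-zero : ∀ {r′} (c : Vec ℕ (suc r′)) (L : ℕ → List (Tuple (suc r′))) →
    (∀ m → Enumerates c 0 m (L m)) → NonNegPoly (λ m → + length (L m)) 0 (+ 1)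
  nonNegPoly-zero {r′} c L L-enum = nothing-positive , (λ _ → ℤ.+≤+ z≤n) , cong +_ only-emptyTuple
    where
    r : ℕ
    r = suc r′
    sound : ∀ {m Λ} → Λ ∈ L m → Λ ≡ emptyTuple r × size Λ ≡ m
    sound {m} {Λ} Λ∈ with proj₁ (proj₂ (L-enum m) Λ) Λ∈
    ... | (parts , _) , Λ≤0 , size≡m = PartsAtMost-0⇒emptyTuple Λ≤0 parts , size≡m
    nothing-positive : ∀ m → 0 < m → + length (L m) ≡ + 0
    nothing-positive m 0<m = cong +_ (length-empty (L m) λ Λ∈ → let (Λ≡ , size≡m) = sound Λ∈ in
      ℕP.<⇒≢ 0<m (trans (sym (size-emptyTuple r)) (trans (cong size (sym Λ≡)) size≡m)))
    only-emptyTuple : length (L 0) ≡ 1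
    only-emptyTuple = length-unique-∼set (proj₁ (L-enum 0)) ([] ∷ []) (mk⇔ (λ Λ∈ → here (proj₁ (sound Λ∈)))
      λ { (here refl) → proj₂ (proj₂ (L-enum 0) (emptyTuple r))
          (IsCylindric-emptyTuple c (s≤s z≤n) , PartsAtMost-emptyTuple r 0 , size-emptyTuple r) })

  P-IsNonNegPoly : ∀ {r′} → ℕ → Vec ℕ (suc r′) → (ℕ → List (Tuple (suc r′))) → Set
  P-IsNonNegPoly {r′} n c L =
    Σ ℕ λ D →
      NonNegPoly (pochTimes (suc r′) n (λ m → + length (L m))) D (+ (profileCount (suc r′) (level c) ^ n))

  nonNegPoly-suc : ∀ {r′} n →
    (∀ (c : Vec ℕ (suc r′)) L → (∀ m → Enumerates c n m (L m)) → P-IsNonNegPoly n c L) →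
    ∀ (c : Vec ℕ (suc r′)) L → (∀ m → Enumerates c (suc n) m (L m)) → P-IsNonNegPoly (suc n) c L
  nonNegPoly-suc {r′} n IH c L L-enum =
    let (D , poly) = NonNegPoly-sumSeries runs F (N ^ n) term in
    D , NonNegPoly-cong (sym ∘ pochTimes-recurrence)
          (subst (λ k → NonNegPoly (sumSeries runs F) D (+ (k * N ^ n))) length-runs poly)
    where
    open Recurrence n c L L-enum
    N : ℕ
    N = profileCount (suc r′) (level c)
    F : Vec ℕ (suc r′) → Series
    F M = shift (weight M) (pochTimes (suc r′) n (countStripped M))
    term : ∀ {M} → M ∈ runs → Σ ℕ λ D → NonNegPoly (F M) D (+ (N ^ n))
    term {M} M∈ =
      let (D , poly) = IH (strippedProfile c M) (stripped M) (stripped-enumerates M∈) in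
      weight M + D , NonNegPoly-shift (weight M)
        (subst (λ ℓ → NonNegPoly (pochTimes (suc r′) n (countStripped M)) D (+ (profileCount (suc r′) ℓ ^ n)))
               (runs-level M∈) poly)

  nonNegPoly : ∀ {r′} n (c : Vec ℕ (suc r′)) L → (∀ m → Enumerates c n m (L m)) → P-IsNonNegPoly n c L
  nonNegPoly zero    c L L-enum = 0 , nonNegPoly-zero c L L-enum
  nonNegPoly (suc n) c L L-enum = nonNegPoly-suc n (nonNegPoly n) c L L-enum

open import Defs
open import Data.Nat using (ℕ; zero; suc; _<_; _+_; _∸_; _^_)
open import Data.Nat.Combinatorics using (_C_)
open import Data.Integer using (+_; _≤_)
open import Data.List using (List; length)
open import Data.Vec using (Vec; [])
open import Data.Product using (Σ; _×_)
open import Relation.Binary.PropositionalEquality using (_≡_)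
open import Relation.Nullary using (contradiction)
open import Data.Nat.Properties using (n≮n)
open CylindricPartitions using (nonNegPoly)

corollary10 : ∀ {r : ℕ} (c : Vec ℕ r) → 0 < level c → (n : ℕ) →
    (enum : ℕ → List (Tuple r)) → (∀ m → Enumerates c n m (enum m)) →
    Σ ℕ (λ D →
      (∀ m → D < m → pochTimes r n (λ k → + length (enum k)) m ≡ + 0) ×
      (∀ m → + 0 ≤ pochTimes r n (λ k → + length (enum k)) m) ×
      (sumTo D (pochTimes r n (λ k → + length (enum k)))
        ≡ + (((level c + r ∸ 1) C (r ∸ 1)) ^ n)))
-- The level hypothesis only serves to exclude rank 0; in positive rank every profile works.
corollary10 {zero}  [] 0<0 = contradiction 0<0 (n≮n 0)
corollary10 {suc r′} c _ n = nonNegPoly n c
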